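{- Let $I_4=\{1,2,3,4\}$, let $\varphi_1,\varphi_2\in S_{I_4}$, let $\mathfrak{N}_1,\mathfrak{N}_2$ be Veblen configurations defined on $\wp_2(I_4)$, and let $f$ be a bijection from the point set of $\mathfrak{K}_{\varphi_1,\mathfrak{N}_1}$ onto the point set of $\mathfrak{K}_{\varphi_2,\mathfrak{N}_2}$. Then the following are equivalent: (i) $f$ is an isomorphism of $\mathfrak{K}_{\varphi_1,\mathfrak{N}_1}$ onto $\mathfrak{K}_{\varphi_2,\mathfrak{N}_2}$; (ii) there is $\alpha\in S_{I_4}$ such that one of the following holds: (a) $f(a_i)=a_{\alpha(i)}$, $f(b_i)=b_{\alpha(i)}$ for $i\in I_4$, $f(c_{\{i,j\}})=c_{\{\alpha(i),\alpha(j)\}}$ for all $\{i,j\}\in\wp_2(I_4)$; $\bar\alpha$ is an isomorphism of $\mathfrak{N}_1$ onto $\mathfrak{N}_2$; and $\varphi_2=\alpha\varphi_1\alpha^{ -1}$; or (b) $f(a_i)=b_{\alpha(i)}$, $f(b_i)=a_{\alpha(i)}$ for $i\in I_4$, $f(c_{\{i,j\}})=c_{\varkappa\overline{\varphi_2^{ -1}\alpha}(\{i,j\})}$ for all $\{i,j\}\in\wp_2(I_4)$; $\varkappa\circ\overline{\varphi_2^{ -1}\alpha}$ is an isomorphism of $\mathfrak{N}_1$ onto $\mathfrak{N}_2$; and $\varphi_2^{ -1}=\alpha\varphi_1\alpha^{ -1}$. Moreover, the last condition in (b) implies $\varkappa\circ\overline{\varphi_2^{ -1}\alpha}=\varkap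pa\circ\overline{\alpha\varphi_1}$.
   Context: $\wp_2(I_4)$ is the set of 2-element subsets of $I_4$ and $S_{I_4}$ the group of permutations of $I_4$. For $\psi\in S_{I_4}$, $\bar\psi$ is the induced bijection $\{i,j\}\mapsto\{\psi(i),\psi(j)\}$ of $\wp_2(I_4)$; $\varkappa(u)=I_4\setminus u$ for $u\in\wp_2(I_4)$. A Veblen configuration on $\wp_2(I_4)$ is a family of four 3-element subsets of $\wp_2(I_4)$ ("lines") such that every element of $\wp_2(I_4)$ lies on exactly two lines and any two lines meet in exactly one element; a bijection $g$ of $\wp_2(I_4)$ is an isomorphism of $\mathfrak{N}_1$ onto $\mathfrak{N}_2$ if it maps the lines of $\mathfrak{N}_1$ onto the lines of $\mathfrak{N}_2$. Take pairwise distinct symbols $p$, $a_i,b_i$ ($i\in I_4$), $c_u$ ($u\in\wp_2(I_4)$). For a bijection $\delta$ of $\wp_2(I_4)$, $\mathbf{\Pi}(p,\delta,\mathfrak{N})$ is the incidence structure with points $p,a_i,b_i,c_u$ and lines: $\{c_u:u\in L\}$ for each line $L$ of $\mathfrak{N}$; $\{a_i,a_j,c_{\{i,j\}}\}$ and $\{b_i,b_j,c_{\delta^{ -1}(\{i,j\})}\}$ for $\{i,j\}\in\wp_2(I_4)$; and $\{p,a_i,b_i\}$ for $i\in I_4$. Define $\mathfrak{K}_{\varphi,\mathfrak{N}}:=\mathbf{\Pi}(p,\bar\varphi\varkappa,\mathfrak{N})$; thus in it the line through $b_i,b_j$ contains $c_{\varkappa\overline{\varphi^{ -1}}(\{i,j\})}$.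 An isomorphism of incidence structures is a bijection of point sets mapping lines onto lines. -}

module Defs where

open import Data.Nat using (ℕ; zero; suc)
open import Data.Fin using (Fin; zero; suc)
open import Data.Fin.Properties using () renaming (_≟_ to _≟F_)
open import Data.Fin.Permutation using (Permutation′; _⟨$⟩ʳ_; _⟨$⟩ˡ_; flip; inverseʳ; inverseˡ)
open import Data.Bool using (Bool; true; false; _∨_; _∧_; if_then_else_)
open import Data.List using (List; []; _∷_; allFin)
open import Data.Product using (_×_; _,_; ∃-syntax)
open import Data.Sum using (_⊎_; inj₁; inj₂)
open import Data.Empty using (⊥-elim)
open import Function using (_∘_; _⇔_; _↔_; mk↔ₛ′; Inverse)
open import Function.Definitions using (Bijective)
open import Relation.Nullary using (¬_; Dec; yes; no; does)
open import Relation.Binary.PropositionalEquality using (_≡_; _≢_; refl; cong; sym; trans)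

-- I₄ = Fin 4 (elements 0,1,2,3 stand for 1,2,3,4); S_{I₄} = Permutation′ 4.

I₄ : Set
I₄ = Fin 4

Perm : Set
Perm = Permutation′ 4

-- ℘₂(I₄): the six 2-element subsets, {i,j} with i < j.
data P2 : Set where
  e01 e02 e03 e12 e13 e23 : P2

fst snd : P2 → I₄
fst e01 = zero
fst e02 = zero
fst e03 = zero
fst e12 = suc zero
fst e13 = suc zero
fst e23 = suc (suc zero)
snd e01 = suc zero
snd e02 = suc (suc zero)
snd e03 = suc (suc (suc zero))
snd e12 = suc (suc zero)
snd e13 = suc (suc (suc zero))
snd e23 = suc (suc (suc zero))

_∈₂_ : I₄ → P2 → Bool
i ∈₂ u = does (i ≟F fst u) ∨ does (i ≟F snd u)

-- pr i j = {i,j}  (for i ≢ j; the diagonal value is an irrelevant convention,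
-- only ever used with injective maps)
pr : I₄ → I₄ → P2
pr zero zero = e01
pr zero (suc zero) = e01
pr zero (suc (suc zero)) = e02
pr zero (suc (suc (suc zero))) = e03
pr (suc zero) zero = e01
pr (suc zero) (suc zero) = e01
pr (suc zero) (suc (suc zero)) = e12
pr (suc zero) (suc (suc (suc zero))) = e13
pr (suc (suc zero)) zero = e02
pr (suc (suc zero)) (suc zero) = e12
pr (suc (suc zero)) (suc (suc zero)) = e01
pr (suc (suc zero)) (suc (suc (suc zero))) = e23
pr (suc (suc (suc zero))) zero = e03
pr (suc (suc (suc zero))) (suc zero) = e13
pr (suc (suc (suc zero))) (suc (suc zero)) = e23
pr (suc (suc (suc zero))) (suc (suc (suc zero))) = e01

barF : (I₄ → I₄) → P2 → P2
barF ψ u = pr (ψ (fst u)) (ψ (snd u))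

bar : Perm → P2 → P2
bar ψ = barF (ψ ⟨$⟩ʳ_)

-- ϰ(u) = I₄ ∖ u
ϰ : P2 → P2
ϰ e01 = e23
ϰ e02 = e13
ϰ e03 = e12
ϰ e12 = e03
ϰ e13 = e02
ϰ e23 = e01

private
  ϰϰ : ∀ u → ϰ (ϰ u) ≡ u
  ϰϰ e01 = refl
  ϰϰ e02 = refl
  ϰϰ e03 = refl
  ϰϰ e12 = refl
  ϰϰ e13 = refl
  ϰϰ e23 = refl

  pr-fs : ∀ u → pr (fst u) (snd u) ≡ u
  pr-fs e01 = refl
  pr-fs e02 = refl
  pr-fs e03 = refl
  pr-fs e12 = refl
  pr-fs e13 = refl
  pr-fs e23 = refl

  pr-sym : ∀ i j → pr i j ≡ pr j i
  pr-sym zero zero = refl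
  pr-sym zero (suc zero) = refl
  pr-sym zero (suc (suc zero)) = refl
  pr-sym zero (suc (suc (suc zero))) = refl
  pr-sym (suc zero) zero = refl
  pr-sym (suc zero) (suc zero) = refl
  pr-sym (suc zero) (suc (suc zero)) = refl
  pr-sym (suc zero) (suc (suc (suc zero))) = refl
  pr-sym (suc (suc zero)) zero = refl
  pr-sym (suc (suc zero)) (suc zero) = refl
  pr-sym (suc (suc zero)) (suc (suc zero)) = refl
  pr-sym (suc (suc zero)) (suc (suc (suc zero))) = refl
  pr-sym (suc (suc (suc zero))) zero = refl
  pr-sym (suc (suc (suc zero))) (suc zero) = refl
  pr-sym (suc (suc (suc zero))) (suc (suc zero)) = refl
  pr-sym (suc (suc (suc zero))) (suc (suc (suc zero))) = refl

  Elems : I₄ → I₄ → P2 → Set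
  Elems i j u = (fst u ≡ i × snd u ≡ j) ⊎ (fst u ≡ j × snd u ≡ i)

  fs-pr : ∀ i j → i ≢ j → Elems i j (pr i j)
  fs-pr zero zero n = ⊥-elim (n refl)
  fs-pr zero (suc zero) n = inj₁ (refl , refl)
  fs-pr zero (suc (suc zero)) n = inj₁ (refl , refl)
  fs-pr zero (suc (suc (suc zero))) n = inj₁ (refl , refl)
  fs-pr (suc zero) zero n = inj₂ (refl , refl)
  fs-pr (suc zero) (suc zero) n = ⊥-elim (n refl)
  fs-pr (suc zero) (suc (suc zero)) n = inj₁ (refl , refl)
  fs-pr (suc zero) (suc (suc (suc zero))) n = inj₁ (refl , refl)
  fs-pr (suc (suc zero)) zero n = inj₂ (refl , refl)
  fs-pr (suc (suc zero)) (suc zero) n = inj₂ (refl , refl)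
  fs-pr (suc (suc zero)) (suc (suc zero)) n = ⊥-elim (n refl)
  fs-pr (suc (suc zero)) (suc (suc (suc zero))) n = inj₁ (refl , refl)
  fs-pr (suc (suc (suc zero))) zero n = inj₂ (refl , refl)
  fs-pr (suc (suc (suc zero))) (suc zero) n = inj₂ (refl , refl)
  fs-pr (suc (suc (suc zero))) (suc (suc zero)) n = inj₂ (refl , refl)
  fs-pr (suc (suc (suc zero))) (suc (suc (suc zero))) n = ⊥-elim (n refl)

  fst≢snd : ∀ u → fst u ≢ snd u
  fst≢snd e01 ()
  fst≢snd e02 ()
  fst≢snd e03 ()
  fst≢snd e12 ()
  fst≢snd e13 ()
  fst≢snd e23 ()

  barF-inv : (ψ ψ′ : I₄ → I₄) → (∀ i → ψ (ψ′ i) ≡ i) → (∀ i → ψ′ (ψ i) ≡ i) →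
             ∀ u → barF ψ (barF ψ′ u) ≡ u
  barF-inv ψ ψ′ r l u with fs-pr (ψ′ (fst u)) (ψ′ (snd u))
                               (λ e → fst≢snd u (trans (sym (r (fst u))) (trans (cong ψ e) (r (snd u)))))
  ... | inj₁ (e1 , e2) rewrite e1 | e2 | r (fst u) | r (snd u) = pr-fs u
  ... | inj₂ (e1 , e2) rewrite e1 | e2 | r (fst u) | r (snd u) = trans (pr-sym (snd u) (fst u)) (pr-fs u)

barϰ : Perm → P2 ↔ P2
barϰ φ = mk↔ₛ′ (bar φ ∘ ϰ) (ϰ ∘ bar (flip φ))
  (λ u → trans (cong (bar φ) (ϰϰ (bar (flip φ) u)))
               (barF-inv (φ ⟨$⟩ʳ_) (φ ⟨$⟩ˡ_) (λ i → inverseʳ φ) (λ i → inverseˡ φ) u))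
  (λ u → trans (cong ϰ (barF-inv (φ ⟨$⟩ˡ_) (φ ⟨$⟩ʳ_) (λ i → inverseˡ φ) (λ i → inverseʳ φ) (ϰ u)))
               (ϰϰ u))

countB : {A : Set} → List A → (A → Bool) → ℕ
countB [] P = zero
countB (x ∷ xs) P = if P x then suc (countB xs P) else countB xs P

allP2 : List P2
allP2 = e01 ∷ e02 ∷ e03 ∷ e12 ∷ e13 ∷ e23 ∷ []

-- Lines as indexed families of subsets (characteristic functions);
-- the line set of a structure is the image of the family.

Image : {A B : Set} → (A → B) → (A → Bool) → B → Set
Image f S y = ∃[ x ] (S x ≡ true × f x ≡ y)

MapsLinesOnto : {A B I J : Set} → (A → B) → (I → A → Bool) → (J → B → Bool) → Set
MapsLinesOnto f L₁ L₂ =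
  (∀ k → ∃[ k′ ] (∀ y → Image f (L₁ k) y ⇔ (L₂ k′ y ≡ true))) ×
  (∀ k′ → ∃[ k ] (∀ y → Image f (L₁ k) y ⇔ (L₂ k′ y ≡ true)))

record Veblen : Set where
  field
    line     : Fin 4 → P2 → Bool
    three    : ∀ k → countB allP2 (line k) ≡ 3
    onTwo    : ∀ u → countB (allFin 4) (λ k → line k u) ≡ 2
    meetOne  : ∀ k l → k ≢ l → countB allP2 (λ u → line k u ∧ line l u) ≡ 1
open Veblen public

VIso : Veblen → Veblen → (P2 → P2) → Set
VIso N₁ N₂ g = Bijective _≡_ _≡_ g × MapsLinesOnto g (line N₁) (line N₂)

data Pt : Set where
  p : Pt
  a b : I₄ → Pt
  c : P2 → Pt

_≟P2_ : (u v : P2) → Dec (u ≡ v)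
e01 ≟P2 e01 = yes refl
e02 ≟P2 e02 = yes refl
e03 ≟P2 e03 = yes refl
e12 ≟P2 e12 = yes refl
e13 ≟P2 e13 = yes refl
e23 ≟P2 e23 = yes refl
e01 ≟P2 e02 = no λ ()
e01 ≟P2 e03 = no λ ()
e01 ≟P2 e12 = no λ ()
e01 ≟P2 e13 = no λ ()
e01 ≟P2 e23 = no λ ()
e02 ≟P2 e01 = no λ ()
e02 ≟P2 e03 = no λ ()
e02 ≟P2 e12 = no λ ()
e02 ≟P2 e13 = no λ ()
e02 ≟P2 e23 = no λ ()
e03 ≟P2 e01 = no λ ()
e03 ≟P2 e02 = no λ ()
e03 ≟P2 e12 = no λ ()
e03 ≟P2 e13 = no λ ()
e03 ≟P2 e23 = no λ ()
e12 ≟P2 e01 = no λ ()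
e12 ≟P2 e02 = no λ ()
e12 ≟P2 e03 = no λ ()
e12 ≟P2 e13 = no λ ()
e12 ≟P2 e23 = no λ ()
e13 ≟P2 e01 = no λ ()
e13 ≟P2 e02 = no λ ()
e13 ≟P2 e03 = no λ ()
e13 ≟P2 e12 = no λ ()
e13 ≟P2 e23 = no λ ()
e23 ≟P2 e01 = no λ ()
e23 ≟P2 e02 = no λ ()
e23 ≟P2 e03 = no λ ()
e23 ≟P2 e12 = no λ ()
e23 ≟P2 e13 = no λ ()

isA isB : I₄ → Pt → Bool
isA i (a j) = does (i ≟F j)
isA i _ = false
isB i (b j) = does (i ≟F j)
isB i _ = false

isC : P2 → Pt → Bool
isC u (c v) = does (u ≟P2 v)
isC u _ = false

isP : Pt → Bool
isP p = true
isP _ = false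

-- line indices: lines of 𝔑, lines {a_i,a_j,c_{ij}}, lines {b_i,b_j,c_{δ⁻¹{i,j}}},
-- lines {p,a_i,b_i}
data LIdx : Set where
  nL : Fin 4 → LIdx
  aL bL : P2 → LIdx
  pL : I₄ → LIdx

ΠLine : (δ : P2 ↔ P2) → Veblen → LIdx → Pt → Bool
ΠLine δ N (nL k) (c u) = line N k u
ΠLine δ N (nL k) _ = false
ΠLine δ N (aL u) x = isA (fst u) x ∨ isA (snd u) x ∨ isC u x
ΠLine δ N (bL u) x = isB (fst u) x ∨ isB (snd u) x ∨ isC (Inverse.from δ u) x
ΠLine δ N (pL i) x = isP x ∨ isA i x ∨ isB i x

KLine : Perm → Veblen → LIdx → Pt → Bool
KLine φ N = ΠLine (barϰ φ) N

-- The points of 𝔎_{φ,𝔑} not collinear with p are exactly the c_u, and a line through two of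
-- them consists of c-points only.  An isomorphism transports this property to the image of p,
-- and no a_i or b_i has it; nor can p go to some c_u, since c_u and a_i (i ∈ u) do not have
-- three pairwise collinear common neighbours off their common line.  So p is fixed and the a_i,
-- b_i are permuted among themselves; as a line through p contains only one a-point, either
-- every a_i goes to some a_{α i} (case (a)) or every a_i goes to some b_{α i} (case (b)).  The
-- lines {a_i, a_j, c_{ij}} then determine the action on the c_u, lines of 𝔑 can only go to
-- lines of 𝔑, and comparing the third points of the b-lines of both structures is exactly the
-- conjugacy condition on φ₁ and φ₂.  Conversely, a map of either form visibly sends each of
-- the four kinds of lines onto lines.
module Submission where

open import Defs
open import Data.Bool using (Bool; true)
open import Data.Bool.Properties using (∨-zeroʳ)
open import Data.Empty using (⊥; ⊥-elim)
open import Data.Fin.Patterns using (0F)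
open import Data.Fin.Permutation using (_⟨$⟩ʳ_; _⟨$⟩ˡ_; inverseʳ; inverseˡ)
open import Data.Fin.Properties using (all?; any?) renaming (_≟_ to _≟F_)
open import Data.Product using (_×_; _,_; proj₁; proj₂; ∃-syntax)
open import Data.Sum using (_⊎_; inj₁; inj₂)
open import Function using (_∘_; _⇔_; _↔_; mk⇔; mk↔ₛ′; Equivalence; Inverse)
open import Function.Definitions using (Injective; Bijective)
open import Relation.Binary.PropositionalEquality using (_≡_; _≢_; refl; sym; trans; cong; subst; subst₂; module ≡-Reasoning)
open import Relation.Nullary using (¬_; Dec; yes; no)
open import Relation.Nullary.Decidable using (from-yes; dec-true; ¬?; _×-dec_; _⊎-dec_; _→-dec_; map′)

-- Incidence structures whose lines are given by characteristic functions

retraction⇒injective : {A B : Set} {f : A → B} (g : B → A) → (∀ x → g (f x) ≡ x) → Injective _≡_ _≡_ f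
retraction⇒injective g gf {x} {y} e = trans (sym (gf x)) (trans (cong g e) (gf y))

bijective-from-inverse : {A B : Set} {f : A → B} (g : B → A) →
  (∀ x → g (f x) ≡ x) → (∀ y → f (g y) ≡ y) → Bijective _≡_ _≡_ f
bijective-from-inverse {f = f} g gf fg =
  retraction⇒injective g gf , λ y → g y , λ {z} z≡gy → trans (cong f z≡gy) (fg y)

OneOf3 : {A : Set} → A → A → A → A → Set
OneOf3 x₁ x₂ x₃ x = x ≡ x₁ ⊎ x ≡ x₂ ⊎ x ≡ x₃

pigeonhole-three : {A : Set} {R : A → A → Set} {P : A → Set} → (∀ {x y} → R x y → R y x) →
  ∀ {y₁ y₂ y₃ z₁ z₂ z₃} → OneOf3 y₁ y₂ y₃ z₁ → OneOf3 y₁ y₂ y₃ z₂ → OneOf3 y₁ y₂ y₃ z₃ →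
  z₁ ≢ z₂ → z₁ ≢ z₃ → z₂ ≢ z₃ → R z₁ z₂ → R z₁ z₃ → R z₂ z₃ → P z₁ → P z₂ → P z₃ →
  R y₁ y₂ × R y₁ y₃ × P y₁
pigeonhole-three R-sym (inj₁ refl) (inj₂ (inj₁ refl)) (inj₂ (inj₂ refl)) _ _ _ r₁₂ r₁₃ r₂₃ q₁ q₂ q₃ =
  r₁₂ , r₁₃ , q₁
pigeonhole-three R-sym (inj₁ refl) (inj₂ (inj₂ refl)) (inj₂ (inj₁ refl)) _ _ _ r₁₂ r₁₃ r₂₃ q₁ q₂ q₃ =
  r₁₃ , r₁₂ , q₁
pigeonhole-three R-sym (inj₂ (inj₁ refl)) (inj₁ refl) (inj₂ (inj₂ refl)) _ _ _ r₁₂ r₁₃ r₂₃ q₁ q₂ q₃ =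
  R-sym r₁₂ , r₂₃ , q₂
pigeonhole-three R-sym (inj₂ (inj₁ refl)) (inj₂ (inj₂ refl)) (inj₁ refl) _ _ _ r₁₂ r₁₃ r₂₃ q₁ q₂ q₃ =
  R-sym r₁₃ , R-sym r₂₃ , q₃
pigeonhole-three R-sym (inj₂ (inj₂ refl)) (inj₁ refl) (inj₂ (inj₁ refl)) _ _ _ r₁₂ r₁₃ r₂₃ q₁ q₂ q₃ =
  r₂₃ , R-sym r₁₂ , q₂
pigeonhole-three R-sym (inj₂ (inj₂ refl)) (inj₂ (inj₁ refl)) (inj₁ refl) _ _ _ r₁₂ r₁₃ r₂₃ q₁ q₂ q₃ =
  R-sym r₂₃ , R-sym r₁₃ , q₃
pigeonhole-three _ (inj₁ refl) (inj₁ refl) _ z₁≢z₂ _ _ _ _ _ _ _ _ = ⊥-elim (z₁≢z₂ refl)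
pigeonhole-three _ (inj₂ (inj₁ refl)) (inj₂ (inj₁ refl)) _ z₁≢z₂ _ _ _ _ _ _ _ _ = ⊥-elim (z₁≢z₂ refl)
pigeonhole-three _ (inj₂ (inj₂ refl)) (inj₂ (inj₂ refl)) _ z₁≢z₂ _ _ _ _ _ _ _ _ = ⊥-elim (z₁≢z₂ refl)
pigeonhole-three _ (inj₁ refl) _ (inj₁ refl) _ z₁≢z₃ _ _ _ _ _ _ _ = ⊥-elim (z₁≢z₃ refl)
pigeonhole-three _ (inj₂ (inj₁ refl)) _ (inj₂ (inj₁ refl)) _ z₁≢z₃ _ _ _ _ _ _ _ = ⊥-elim (z₁≢z₃ refl)
pigeonhole-three _ (inj₂ (inj₂ refl)) _ (inj₂ (inj₂ refl)) _ z₁≢z₃ _ _ _ _ _ _ _ = ⊥-elim (z₁≢z₃ refl)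
pigeonhole-three _ _ (inj₁ refl) (inj₁ refl) _ _ z₂≢z₃ _ _ _ _ _ _ = ⊥-elim (z₂≢z₃ refl)
pigeonhole-three _ _ (inj₂ (inj₁ refl)) (inj₂ (inj₁ refl)) _ _ z₂≢z₃ _ _ _ _ _ _ = ⊥-elim (z₂≢z₃ refl)
pigeonhole-three _ _ (inj₂ (inj₂ refl)) (inj₂ (inj₂ refl)) _ _ z₂≢z₃ _ _ _ _ _ _ = ⊥-elim (z₂≢z₃ refl)

record HasPoints {A I : Set} (L : I → A → Bool) (k : I) (x₁ x₂ x₃ : A) : Set where
  constructor has-points
  field incidence : ∀ x → L k x ≡ true ⇔ OneOf3 x₁ x₂ x₃ x
open HasPoints

module _ {A I : Set} {L : I → A → Bool} {k : I} {x₁ x₂ x₃ : A} (h : HasPoints L k x₁ x₂ x₃) where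

  on-line : ∀ x → L k x ≡ true → OneOf3 x₁ x₂ x₃ x
  on-line x = Equivalence.to (incidence h x)

  point₁ : L k x₁ ≡ true
  point₁ = Equivalence.from (incidence h x₁) (inj₁ refl)

  point₂ : L k x₂ ≡ true
  point₂ = Equivalence.from (incidence h x₂) (inj₂ (inj₁ refl))

  point₃ : L k x₃ ≡ true
  point₃ = Equivalence.from (incidence h x₃) (inj₂ (inj₂ refl))

  HasPoints-swap₁₂ : HasPoints L k x₂ x₁ x₃
  HasPoints-swap₁₂ = has-points λ x →
    mk⇔ (swap ∘ Equivalence.to (incidence h x)) (Equivalence.from (incidence h x) ∘ swap)
    where
    swap : ∀ {y₁ y₂ x} → OneOf3 y₁ y₂ x₃ x → OneOf3 y₂ y₁ x₃ x
    swap (inj₁ e) = inj₂ (inj₁ e)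
    swap (inj₂ (inj₁ e)) = inj₁ e
    swap (inj₂ (inj₂ e)) = inj₂ (inj₂ e)

  HasPoints-swap₂₃ : HasPoints L k x₁ x₃ x₂
  HasPoints-swap₂₃ = has-points λ x →
    mk⇔ (swap ∘ Equivalence.to (incidence h x)) (Equivalence.from (incidence h x) ∘ swap)
    where
    swap : ∀ {y₂ y₃ x} → OneOf3 x₁ y₂ y₃ x → OneOf3 x₁ y₃ y₂ x
    swap (inj₁ e) = inj₁ e
    swap (inj₂ (inj₁ e)) = inj₂ (inj₂ e)
    swap (inj₂ (inj₂ e)) = inj₂ (inj₁ e)

record Collinear {A I : Set} (L : I → A → Bool) (x y : A) : Set where
  constructor collinear
  field
    common-line : I
    first-on : L common-line x ≡ true
    second-on : L common-line y ≡ true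

collinear-sym : {A I : Set} {L : I → A → Bool} {x y : A} → Collinear L x y → Collinear L y x
collinear-sym (collinear k x∈k y∈k) = collinear k y∈k x∈k

MapsLineOnto : {A B : Set} → (A → B) → (A → Bool) → (B → Bool) → Set
MapsLineOnto F ℓ₁ ℓ₂ = ∀ y → Image F ℓ₁ y ⇔ (ℓ₂ y ≡ true)

three-point-lines-correspond : {A B I J : Set} {L₁ : I → A → Bool} {L₂ : J → B → Bool} {F : A → B}
  {k : I} {k′ : J} {x₁ x₂ x₃ : A} {y₁ y₂ y₃ : B} →
  HasPoints L₁ k x₁ x₂ x₃ → HasPoints L₂ k′ y₁ y₂ y₃ →
  F x₁ ≡ y₁ → F x₂ ≡ y₂ → F x₃ ≡ y₃ → MapsLineOnto F (L₁ k) (L₂ k′)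
three-point-lines-correspond {L₁ = L₁} {L₂} {F} {k} {k′} {x₁} {x₂} {x₃} hx hy e₁ e₂ e₃ y = mk⇔ to from
  where
  to : Image F (L₁ k) y → L₂ k′ y ≡ true
  to (x , x∈ , refl) with on-line hx x x∈
  ... | inj₁ refl = subst (λ t → L₂ k′ t ≡ true) (sym e₁) (point₁ hy)
  ... | inj₂ (inj₁ refl) = subst (λ t → L₂ k′ t ≡ true) (sym e₂) (point₂ hy)
  ... | inj₂ (inj₂ refl) = subst (λ t → L₂ k′ t ≡ true) (sym e₃) (point₃ hy)
  from : L₂ k′ y ≡ true → Image F (L₁ k) y
  from y∈ with on-line hy y y∈
  ... | inj₁ refl = x₁ , point₁ hx , e₁
  ... | inj₂ (inj₁ refl) = x₂ , point₂ hx , e₂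
  ... | inj₂ (inj₂ refl) = x₃ , point₃ hx , e₃

module LineBijection {A B I J : Set} {L₁ : I → A → Bool} {L₂ : J → B → Bool}
                     (f : A ↔ B) (maps : MapsLinesOnto (Inverse.to f) L₁ L₂) where

  F : A → B
  F = Inverse.to f

  G : B → A
  G = Inverse.from f

  F∘G : ∀ y → F (G y) ≡ y
  F∘G y = Inverse.inverseˡ f refl

  G∘F : ∀ x → G (F x) ≡ x
  G∘F x = Inverse.inverseʳ f refl

  F-injective : Injective _≡_ _≡_ F
  F-injective = retraction⇒injective G G∘F

  G-injective : Injective _≡_ _≡_ G
  G-injective = retraction⇒injective F F∘G

  image-line : I → J
  image-line k = proj₁ (proj₁ maps k)

  preimage-line : J → I
  preimage-line k′ = proj₁ (proj₂ maps k′)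

  image-line-onto : ∀ k → MapsLineOnto F (L₁ k) (L₂ (image-line k))
  image-line-onto k = proj₂ (proj₁ maps k)

  preimage-line-onto : ∀ k′ → MapsLineOnto F (L₁ (preimage-line k′)) (L₂ k′)
  preimage-line-onto k′ = proj₂ (proj₂ maps k′)

  on-image-line : ∀ k {x y} → F x ≡ y → L₁ k x ≡ true → L₂ (image-line k) y ≡ true
  on-image-line k {x} refl x∈ = Equivalence.to (image-line-onto k (F x)) (x , x∈ , refl)

  on-preimage-line : ∀ k′ {x y} → F x ≡ y → L₂ k′ y ≡ true → L₁ (preimage-line k′) x ≡ true
  on-preimage-line k′ {x} refl Fx∈ with Equivalence.from (preimage-line-onto k′ (F x)) Fx∈
  ... | x′ , x′∈ , Fx′≡Fx = subst (λ t → L₁ (preimage-line k′) t ≡ true) (F-injective Fx′≡Fx) x′∈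

  G-on-preimage-line : ∀ k′ {y x} → G y ≡ x → L₂ k′ y ≡ true → L₁ (preimage-line k′) x ≡ true
  G-on-preimage-line k′ {y} refl = on-preimage-line k′ (F∘G y)

  collinear-image : ∀ {x y} → Collinear L₁ x y → Collinear L₂ (F x) (F y)
  collinear-image (collinear k x∈ y∈) = collinear (image-line k) (on-image-line k refl x∈) (on-image-line k refl y∈)

  collinear-preimage : ∀ {x y} → Collinear L₂ (F x) y → Collinear L₁ x (G y)
  collinear-preimage (collinear k′ x∈ y∈) =
    collinear (preimage-line k′) (on-preimage-line k′ refl x∈) (G-on-preimage-line k′ refl y∈)

  image-of-third-point : ∀ {k k′ x₁ x₂ x₃ y₁ y₂ y₃} →
    HasPoints L₁ k x₁ x₂ x₃ → HasPoints L₂ k′ y₁ y₂ y₃ →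
    (∀ {k″} → L₂ k″ y₁ ≡ true → L₂ k″ y₂ ≡ true → k″ ≡ k′) →
    x₃ ≢ x₁ → x₃ ≢ x₂ → F x₁ ≡ y₁ → F x₂ ≡ y₂ → F x₃ ≡ y₃
  image-of-third-point {k} {x₃ = x₃} hx hy unique x₃≢x₁ x₃≢x₂ e₁ e₂
    with unique (on-image-line k e₁ (point₁ hx)) (on-image-line k e₂ (point₂ hx))
  ... | refl with on-line hy (F x₃) (on-image-line k refl (point₃ hx))
  ...   | inj₁ e = ⊥-elim (x₃≢x₁ (F-injective (trans e (sym e₁))))
  ...   | inj₂ (inj₁ e) = ⊥-elim (x₃≢x₂ (F-injective (trans e (sym e₂))))
  ...   | inj₂ (inj₂ e) = e

-- Pairs of elements of I₄

all-P2? : {P : P2 → Set} → (∀ u → Dec (P u)) → Dec (∀ u → P u)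
all-P2? P? = map′ (λ (h₁ , h₂ , h₃ , h₄ , h₅ , h₆) →
                     λ { e01 → h₁ ; e02 → h₂ ; e03 → h₃ ; e12 → h₄ ; e13 → h₅ ; e23 → h₆ })
                  (λ h → h e01 , h e02 , h e03 , h e12 , h e13 , h e23)
                  (P? e01 ×-dec P? e02 ×-dec P? e03 ×-dec P? e12 ×-dec P? e13 ×-dec P? e23)

_∈ₚ_ : I₄ → P2 → Set
i ∈ₚ u = fst u ≡ i ⊎ snd u ≡ i

_∈ₚ?_ : ∀ i u → Dec (i ∈ₚ u)
i ∈ₚ? u = (fst u ≟F i) ⊎-dec (snd u ≟F i)

Distinct₄ : I₄ → I₄ → I₄ → I₄ → Set
Distinct₄ x y z w = x ≢ y × x ≢ z × x ≢ w × y ≢ z × y ≢ w × z ≢ w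

distinct₄? : ∀ x y z w → Dec (Distinct₄ x y z w)
distinct₄? x y z w = ¬? (x ≟F y) ×-dec ¬? (x ≟F z) ×-dec ¬? (x ≟F w) ×-dec
                     ¬? (y ≟F z) ×-dec ¬? (y ≟F w) ×-dec ¬? (z ≟F w)

Distinct₄-map : ∀ {σ : I₄ → I₄} {x y z w} → Injective _≡_ _≡_ σ →
                Distinct₄ x y z w → Distinct₄ (σ x) (σ y) (σ z) (σ w)
Distinct₄-map inj (n₁ , n₂ , n₃ , n₄ , n₅ , n₆) =
  n₁ ∘ inj , n₂ ∘ inj , n₃ ∘ inj , n₄ ∘ inj , n₅ ∘ inj , n₆ ∘ inj

sibling₁ sibling₂ : P2 → P2
sibling₁ u = pr (fst u) (fst (ϰ u))
sibling₂ u = pr (fst u) (snd (ϰ u))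

-- Each fact is decided by evaluation over all of I₄ and ℘₂(I₄); the block is opaque so that
-- later with-abstractions do not unfold these evaluations.
opaque
 pr-fst-snd : ∀ u → pr (fst u) (snd u) ≡ u
 pr-fst-snd = from-yes (all-P2? λ u → pr (fst u) (snd u) ≟P2 u)

 fst≢snd : ∀ u → fst u ≢ snd u
 fst≢snd = from-yes (all-P2? λ u → ¬? (fst u ≟F snd u))

 ϰ-involutive : ∀ u → ϰ (ϰ u) ≡ u
 ϰ-involutive = from-yes (all-P2? λ u → ϰ (ϰ u) ≟P2 u)

 pr-comm : ∀ i j → pr i j ≡ pr j i
 pr-comm = from-yes (all? λ i → all? λ j → pr i j ≟P2 pr j i)

 pr-elements : ∀ i j → i ≢ j → (fst (pr i j) ≡ i × snd (pr i j) ≡ j) ⊎ (fst (pr i j) ≡ j × snd (pr i j) ≡ i)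
 pr-elements = from-yes (all? λ i → all? λ j → ¬? (i ≟F j) →-dec
   ((fst (pr i j) ≟F i ×-dec snd (pr i j) ≟F j) ⊎-dec (fst (pr i j) ≟F j ×-dec snd (pr i j) ≟F i)))

 pr-injective : ∀ x y z w → x ≢ y → z ≢ w → pr x y ≡ pr z w → (x ≡ z × y ≡ w) ⊎ (x ≡ w × y ≡ z)
 pr-injective = from-yes (all? λ x → all? λ y → all? λ z → all? λ w →
   ¬? (x ≟F y) →-dec ¬? (z ≟F w) →-dec (pr x y ≟P2 pr z w) →-dec
   ((x ≟F z ×-dec y ≟F w) ⊎-dec (x ≟F w ×-dec y ≟F z)))

 pair-of-elements : ∀ w x y → x ∈ₚ w → y ∈ₚ w → x ≢ y → w ≡ pr x y
 pair-of-elements = from-yes (all-P2? λ w → all? λ x → all? λ y →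
   (x ∈ₚ? w) →-dec (y ∈ₚ? w) →-dec ¬? (x ≟F y) →-dec (w ≟P2 pr x y))

 ∈-ϰ-pr : ∀ i x y → x ≢ y → i ≢ x → i ≢ y → i ∈ₚ ϰ (pr x y)
 ∈-ϰ-pr = from-yes (all? λ i → all? λ x → all? λ y →
   ¬? (x ≟F y) →-dec ¬? (i ≟F x) →-dec ¬? (i ≟F y) →-dec (i ∈ₚ? ϰ (pr x y)))

 ∉-ϰ-pr : ∀ i x y → x ≢ y → i ≡ x ⊎ i ≡ y → ¬ i ∈ₚ ϰ (pr x y)
 ∉-ϰ-pr = from-yes (all? λ i → all? λ x → all? λ y →
   ¬? (x ≟F y) →-dec (i ≟F x ⊎-dec i ≟F y) →-dec ¬? (i ∈ₚ? ϰ (pr x y)))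

 ϰ-pr-complement : ∀ x y z w → Distinct₄ x y z w → ϰ (pr x y) ≡ pr z w
 ϰ-pr-complement = from-yes (all? λ x → all? λ y → all? λ z → all? λ w →
   distinct₄? x y z w →-dec (ϰ (pr x y) ≟P2 pr z w))

 ϰ-elements-distinct : ∀ u → Distinct₄ (fst u) (snd u) (fst (ϰ u)) (snd (ϰ u))
 ϰ-elements-distinct = from-yes (all-P2? λ u → distinct₄? (fst u) (snd u) (fst (ϰ u)) (snd (ϰ u)))

 pairs-through-fst : ∀ u v → fst u ∈ₚ v → v ≢ u → v ≡ sibling₁ u ⊎ v ≡ sibling₂ u
 pairs-through-fst = from-yes (all-P2? λ u → all-P2? λ v →
   (fst u ∈ₚ? v) →-dec ¬? (v ≟P2 u) →-dec ((v ≟P2 sibling₁ u) ⊎-dec (v ≟P2 sibling₂ u)))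

 pairs-through-fst-cover : ∀ u j → j ∈ₚ u ⊎ j ∈ₚ sibling₁ u ⊎ j ∈ₚ sibling₂ u
 pairs-through-fst-cover = from-yes (all-P2? λ u → all? λ j →
   (j ∈ₚ? u) ⊎-dec (j ∈ₚ? sibling₁ u) ⊎-dec (j ∈ₚ? sibling₂ u))

 three-others : (m : I₄) → ∃[ n₁ ] ∃[ n₂ ] ∃[ n₃ ] Distinct₄ m n₁ n₂ n₃
 three-others = from-yes (all? λ (m : I₄) → any? λ n₁ → any? λ n₂ → any? λ n₃ → distinct₄? m n₁ n₂ n₃)

 two-outside : (i j : I₄) → ∃[ x ] ∃[ y ] (x ≢ y × i ≢ x × i ≢ y × j ≢ x × j ≢ y)
 two-outside = from-yes (all? λ (i : I₄) → all? λ (j : I₄) → any? λ (x : I₄) → any? λ (y : I₄) →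
   ¬? (x ≟F y) ×-dec ¬? (i ≟F x) ×-dec ¬? (i ≟F y) ×-dec ¬? (j ≟F x) ×-dec ¬? (j ≟F y))

 partner : (i j : I₄) → ∃[ m ] (i ≢ m × (j ≡ i ⊎ j ≡ m))
 partner = from-yes (all? λ (i : I₄) → all? λ (j : I₄) → any? λ (m : I₄) →
   ¬? (i ≟F m) ×-dec (j ≟F i ⊎-dec j ≟F m))

ϰ-injective : Injective _≡_ _≡_ ϰ
ϰ-injective = retraction⇒injective ϰ ϰ-involutive

perm-injective : (π : Perm) → Injective _≡_ _≡_ (π ⟨$⟩ʳ_)
perm-injective π = retraction⇒injective (π ⟨$⟩ˡ_) (λ _ → inverseˡ π)

perm⁻¹-injective : (π : Perm) → Injective _≡_ _≡_ (π ⟨$⟩ˡ_)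
perm⁻¹-injective π = retraction⇒injective (π ⟨$⟩ʳ_) (λ _ → inverseʳ π)

perm-separates-pair : ∀ (π : Perm) w → π ⟨$⟩ʳ fst w ≢ π ⟨$⟩ʳ snd w
perm-separates-pair π w = fst≢snd w ∘ perm-injective π

barF-pr : ∀ σ i j → i ≢ j → barF σ (pr i j) ≡ pr (σ i) (σ j)
barF-pr σ i j i≢j with pr-elements i j i≢j
... | inj₁ (e₁ , e₂) rewrite e₁ | e₂ = refl
... | inj₂ (e₁ , e₂) rewrite e₁ | e₂ = pr-comm (σ j) (σ i)

barF-cong : ∀ {σ τ} → (∀ i → σ i ≡ τ i) → ∀ u → barF σ u ≡ barF τ u
barF-cong σ≗τ u rewrite σ≗τ (fst u) | σ≗τ (snd u) = refl

barF-∘ : ∀ σ {τ} → Injective _≡_ _≡_ τ → ∀ u → barF σ (barF τ u) ≡ barF (σ ∘ τ) u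
barF-∘ σ {τ} τ-inj u = barF-pr σ (τ (fst u)) (τ (snd u)) (fst≢snd u ∘ τ-inj)

barF-inverse : ∀ {σ τ} → Injective _≡_ _≡_ τ → (∀ i → σ (τ i) ≡ i) → ∀ u → barF σ (barF τ u) ≡ u
barF-inverse {σ} {τ} τ-inj στ u = trans (barF-∘ σ τ-inj u) (trans (barF-cong {σ ∘ τ} στ u) (pr-fst-snd u))

barF-ϰ : ∀ {σ} → Injective _≡_ _≡_ σ → ∀ u → barF σ (ϰ u) ≡ ϰ (barF σ u)
barF-ϰ σ-inj u = sym (ϰ-pr-complement _ _ _ _ (Distinct₄-map σ-inj (ϰ-elements-distinct u)))

barF-ϰ-barF : ∀ {σ τ} → Injective _≡_ _≡_ σ → Injective _≡_ _≡_ τ →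
  ∀ w → barF σ (ϰ (barF τ w)) ≡ ϰ (barF (σ ∘ τ) w)
barF-ϰ-barF {σ} {τ} σ-inj τ-inj w = trans (barF-ϰ σ-inj (barF τ w)) (cong ϰ (barF-∘ σ τ-inj w))

barF-cancel : ∀ {g h : I₄ → I₄} → Injective _≡_ _≡_ g → Injective _≡_ _≡_ h →
  (∀ u → barF g u ≡ barF h u) → ∀ x → g x ≡ h x
barF-cancel {g} {h} g-inj h-inj g̅≗h̅ x with two-outside x x
... | j , k , j≢k , x≢j , x≢k , _
  with pr-injective _ _ _ _ (x≢j ∘ g-inj) (x≢j ∘ h-inj) (same-pair x≢j)
     | pr-injective _ _ _ _ (x≢k ∘ g-inj) (x≢k ∘ h-inj) (same-pair x≢k)
  where
  same-pair : ∀ {y} → x ≢ y → pr (g x) (g y) ≡ pr (h x) (h y)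
  same-pair {y} x≢y = trans (sym (barF-pr g x y x≢y)) (trans (g̅≗h̅ (pr x y)) (barF-pr h x y x≢y))
... | inj₁ (gx≡hx , _) | _ = gx≡hx
... | inj₂ _ | inj₁ (gx≡hx , _) = gx≡hx
... | inj₂ (gx≡hj , _) | inj₂ (gx≡hk , _) = ⊥-elim (j≢k (h-inj (trans (sym gx≡hj) gx≡hk)))

HasPoints-pr : {A I : Set} {L : I → A → Bool} {k : I} {x₃ : A} (q : I₄ → A) {x y : I₄} → x ≢ y →
  HasPoints L k (q (fst (pr x y))) (q (snd (pr x y))) x₃ → HasPoints L k (q x) (q y) x₃
HasPoints-pr {L = L} {k} {x₃} q {x} {y} x≢y h with pr-elements x y x≢y
... | inj₁ (e₁ , e₂) = subst₂ (λ s t → HasPoints L k (q s) (q t) x₃) e₁ e₂ h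
... | inj₂ (e₁ , e₂) = HasPoints-swap₁₂ (subst₂ (λ s t → HasPoints L k (q s) (q t) x₃) e₁ e₂ h)

twisted : Perm → Perm → P2 → P2
twisted φ α u = ϰ (barF (λ i → φ ⟨$⟩ˡ (α ⟨$⟩ʳ i)) u)

conjugation : (φ α : Perm) (θ : I₄ → I₄) →
  (∀ x → θ (α ⟨$⟩ʳ (φ ⟨$⟩ˡ x)) ≡ α ⟨$⟩ʳ x) ⇔ (∀ i → θ i ≡ α ⟨$⟩ʳ (φ ⟨$⟩ʳ (α ⟨$⟩ˡ i)))
conjugation φ α θ = mk⇔ to from
  where
  open ≡-Reasoning
  to : (∀ x → θ (α ⟨$⟩ʳ (φ ⟨$⟩ˡ x)) ≡ α ⟨$⟩ʳ x) → ∀ i → θ i ≡ α ⟨$⟩ʳ (φ ⟨$⟩ʳ (α ⟨$⟩ˡ i))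
  to h i = begin
    θ i                                           ≡⟨ cong θ (sym (inverseʳ α)) ⟩
    θ (α ⟨$⟩ʳ (α ⟨$⟩ˡ i))                         ≡⟨ cong (θ ∘ (α ⟨$⟩ʳ_)) (sym (inverseˡ φ)) ⟩
    θ (α ⟨$⟩ʳ (φ ⟨$⟩ˡ (φ ⟨$⟩ʳ (α ⟨$⟩ˡ i))))       ≡⟨ h (φ ⟨$⟩ʳ (α ⟨$⟩ˡ i)) ⟩
    α ⟨$⟩ʳ (φ ⟨$⟩ʳ (α ⟨$⟩ˡ i))                    ∎
  from : (∀ i → θ i ≡ α ⟨$⟩ʳ (φ ⟨$⟩ʳ (α ⟨$⟩ˡ i))) → ∀ x → θ (α ⟨$⟩ʳ (φ ⟨$⟩ˡ x)) ≡ α ⟨$⟩ʳ x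
  from h x = begin
    θ (α ⟨$⟩ʳ (φ ⟨$⟩ˡ x))                         ≡⟨ h _ ⟩
    α ⟨$⟩ʳ (φ ⟨$⟩ʳ (α ⟨$⟩ˡ (α ⟨$⟩ʳ (φ ⟨$⟩ˡ x))))  ≡⟨ cong (λ y → α ⟨$⟩ʳ (φ ⟨$⟩ʳ y)) (inverseˡ α) ⟩
    α ⟨$⟩ʳ (φ ⟨$⟩ʳ (φ ⟨$⟩ˡ x))                    ≡⟨ cong (α ⟨$⟩ʳ_) (inverseʳ φ) ⟩
    α ⟨$⟩ʳ x                                      ∎

b-lines-compatible-A : (φ₁ φ₂ α : Perm) →
  (∀ w → bar α (ϰ (barF (φ₁ ⟨$⟩ˡ_) w)) ≡ ϰ (barF (λ i → φ₂ ⟨$⟩ˡ (α ⟨$⟩ʳ i)) w)) ⇔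
  (∀ x → φ₂ ⟨$⟩ʳ (α ⟨$⟩ʳ (φ₁ ⟨$⟩ˡ x)) ≡ α ⟨$⟩ʳ x)
b-lines-compatible-A φ₁ φ₂ α = mk⇔
  (λ h x → trans (cong (φ₂ ⟨$⟩ʳ_) (barF-cancel {α∘ψ₁} {ψ₂∘α}
                                     (perm⁻¹-injective φ₁ ∘ perm-injective α)
                                     (perm-injective α ∘ perm⁻¹-injective φ₂)
                                     (λ w → ϰ-injective (trans (sym (lhs w)) (h w))) x))
                 (inverseʳ φ₂))
  (λ h w → trans (lhs w) (cong ϰ (barF-cong (λ x → trans (sym (inverseˡ φ₂)) (cong (φ₂ ⟨$⟩ˡ_) (h x))) w)))
  where
  α∘ψ₁ ψ₂∘α : I₄ → I₄
  α∘ψ₁ x = α ⟨$⟩ʳ (φ₁ ⟨$⟩ˡ x)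
  ψ₂∘α x = φ₂ ⟨$⟩ˡ (α ⟨$⟩ʳ x)
  lhs : ∀ w → bar α (ϰ (barF (φ₁ ⟨$⟩ˡ_) w)) ≡ ϰ (barF α∘ψ₁ w)
  lhs = barF-ϰ-barF (perm-injective α) (perm⁻¹-injective φ₁)

b-lines-compatible-B : (φ₁ φ₂ α : Perm) →
  (∀ w → twisted φ₂ α (ϰ (barF (φ₁ ⟨$⟩ˡ_) w)) ≡ bar α w) ⇔
  (∀ x → φ₂ ⟨$⟩ˡ (α ⟨$⟩ʳ (φ₁ ⟨$⟩ˡ x)) ≡ α ⟨$⟩ʳ x)
b-lines-compatible-B φ₁ φ₂ α = mk⇔
  (λ h → barF-cancel {ψ₂∘α∘ψ₁} (perm⁻¹-injective φ₁ ∘ perm-injective α ∘ perm⁻¹-injective φ₂)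
                                (perm-injective α) (λ w → trans (sym (lhs w)) (h w)))
  (λ h w → trans (lhs w) (barF-cong h w))
  where
  ψ₂∘α∘ψ₁ : I₄ → I₄
  ψ₂∘α∘ψ₁ x = φ₂ ⟨$⟩ˡ (α ⟨$⟩ʳ (φ₁ ⟨$⟩ˡ x))
  lhs : ∀ w → twisted φ₂ α (ϰ (barF (φ₁ ⟨$⟩ˡ_) w)) ≡ barF ψ₂∘α∘ψ₁ w
  lhs w = trans (cong ϰ (barF-ϰ-barF (perm-injective α ∘ perm⁻¹-injective φ₂) (perm⁻¹-injective φ₁) w))
                (ϰ-involutive _)

twisted-via-conjugate : ∀ φ₁ φ₂ α → (∀ i → φ₂ ⟨$⟩ˡ i ≡ α ⟨$⟩ʳ (φ₁ ⟨$⟩ʳ (α ⟨$⟩ˡ i))) →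
  ∀ u → twisted φ₂ α u ≡ ϰ (barF (λ i → α ⟨$⟩ʳ (φ₁ ⟨$⟩ʳ i)) u)
twisted-via-conjugate φ₁ φ₂ α conj = cong ϰ ∘ barF-cong λ i →
  trans (conj (α ⟨$⟩ʳ i)) (cong (λ j → α ⟨$⟩ʳ (φ₁ ⟨$⟩ʳ j)) (inverseˡ α))

-- The structure 𝔎_{φ,𝔑}

c-injective : Injective _≡_ _≡_ c
c-injective refl = refl

c≢p : ∀ {u} → c u ≢ p
c≢p ()

pL-injective : ∀ {i j} → pL i ≡ pL j → i ≡ j
pL-injective refl = refl

IsC : Pt → Set
IsC x = ∃[ u ] (x ≡ c u)

data Side : Set where
  a-side b-side : Side

point : Side → I₄ → Pt
point a-side = a
point b-side = b

sideLine : Side → P2 → LIdx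
sideLine a-side = aL
sideLine b-side = bL

opposite : Side → Side
opposite a-side = b-side
opposite b-side = a-side

side-cases : ∀ s t → t ≡ s ⊎ t ≡ opposite s
side-cases a-side a-side = inj₁ refl
side-cases a-side b-side = inj₂ refl
side-cases b-side a-side = inj₂ refl
side-cases b-side b-side = inj₁ refl

point-injective : ∀ s → Injective _≡_ _≡_ (point s)
point-injective a-side refl = refl
point-injective b-side refl = refl

point≢opposite : ∀ s {i j} → point s i ≢ point (opposite s) j
point≢opposite a-side ()
point≢opposite b-side ()

point≢p : ∀ s {i} → point s i ≢ p
point≢p a-side ()
point≢p b-side ()

point-not-c : ∀ s {i} → ¬ IsC (point s i)
point-not-c a-side (_ , ())
point-not-c b-side (_ , ())

module Incidence (φ : Perm) (N : Veblen) where

  L : LIdx → Pt → Bool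
  L = KLine φ N

  ψ : I₄ → I₄
  ψ = φ ⟨$⟩ˡ_

  ψ-injective : Injective _≡_ _≡_ ψ
  ψ-injective = perm⁻¹-injective φ

  -- δ⁻¹ w for δ = φ̄ϰ, the index of the c-point on the b-line bL w.
  c-on-bL : P2 → P2
  c-on-bL w = ϰ (barF ψ w)

  pL-points : ∀ i → HasPoints L (pL i) p (a i) (b i)
  pL-points i = has-points λ x → mk⇔ (to x) from
    where
    to : ∀ x → L (pL i) x ≡ true → OneOf3 p (a i) (b i) x
    to p _ = inj₁ refl
    to (a j) h with i ≟F j
    ... | yes refl = inj₂ (inj₁ refl)
    to (a j) () | no _
    to (b j) h with i ≟F j
    ... | yes refl = inj₂ (inj₂ refl)
    to (b j) () | no _
    from : ∀ {x} → OneOf3 p (a i) (b i) x → L (pL i) x ≡ true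
    from (inj₁ refl) = refl
    from (inj₂ (inj₁ refl)) rewrite dec-true (i ≟F i) refl = refl
    from (inj₂ (inj₂ refl)) = dec-true (i ≟F i) refl

  aL-points : ∀ w → HasPoints L (aL w) (a (fst w)) (a (snd w)) (c w)
  aL-points w = has-points λ x → mk⇔ (to x) from
    where
    to : ∀ x → L (aL w) x ≡ true → OneOf3 (a (fst w)) (a (snd w)) (c w) x
    to (a j) h with fst w ≟F j | snd w ≟F j
    ... | yes refl | _ = inj₁ refl
    ... | no _ | yes refl = inj₂ (inj₁ refl)
    to (a j) () | no _ | no _
    to (c v) h with w ≟P2 v
    ... | yes refl = inj₂ (inj₂ refl)
    to (c v) () | no _
    from : ∀ {x} → OneOf3 (a (fst w)) (a (snd w)) (c w) x → L (aL w) x ≡ true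
    from (inj₁ refl) rewrite dec-true (fst w ≟F fst w) refl = refl
    from (inj₂ (inj₁ refl)) rewrite dec-true (snd w ≟F snd w) refl = ∨-zeroʳ _
    from (inj₂ (inj₂ refl)) = dec-true (w ≟P2 w) refl

  bL-points : ∀ w → HasPoints L (bL w) (b (fst w)) (b (snd w)) (c (c-on-bL w))
  bL-points w = has-points λ x → mk⇔ (to x) from
    where
    to : ∀ x → L (bL w) x ≡ true → OneOf3 (b (fst w)) (b (snd w)) (c (c-on-bL w)) x
    to (b j) h with fst w ≟F j | snd w ≟F j
    ... | yes refl | _ = inj₁ refl
    ... | no _ | yes refl = inj₂ (inj₁ refl)
    to (b j) () | no _ | no _
    to (c v) h with c-on-bL w ≟P2 v
    ... | yes refl = inj₂ (inj₂ refl)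
    to (c v) () | no _
    from : ∀ {x} → OneOf3 (b (fst w)) (b (snd w)) (c (c-on-bL w)) x → L (bL w) x ≡ true
    from (inj₁ refl) rewrite dec-true (fst w ≟F fst w) refl = refl
    from (inj₂ (inj₁ refl)) rewrite dec-true (snd w ≟F snd w) refl = ∨-zeroʳ _
    from (inj₂ (inj₂ refl)) = dec-true (c-on-bL w ≟P2 c-on-bL w) refl

  nL-points : ∀ k x → L (nL k) x ≡ true → ∃[ r ] (x ≡ c r × line N k r ≡ true)
  nL-points k (c r) h = r , refl , h

  pL-side-points : ∀ s i → HasPoints L (pL i) p (point s i) (point (opposite s) i)
  pL-side-points a-side i = pL-points i
  pL-side-points b-side i = HasPoints-swap₂₃ (pL-points i)

  aL-pr-points : ∀ x y → x ≢ y → HasPoints L (aL (pr x y)) (a x) (a y) (c (pr x y))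
  aL-pr-points x y x≢y = HasPoints-pr a x≢y (aL-points (pr x y))

  bL-pr-points : ∀ x y → x ≢ y → HasPoints L (bL (pr x y)) (b x) (b y) (c (ϰ (pr (ψ x) (ψ y))))
  bL-pr-points x y x≢y = HasPoints-pr b x≢y
    (subst (λ v → HasPoints L (bL (pr x y)) _ _ (c (ϰ v))) (barF-pr ψ x y x≢y) (bL-points (pr x y)))

  a-on-aL⇒∈ₚ : ∀ {w z} → L (aL w) (a z) ≡ true → z ∈ₚ w
  a-on-aL⇒∈ₚ {w} {z} z∈ with on-line (aL-points w) (a z) z∈
  ... | inj₁ refl = inj₁ refl
  ... | inj₂ (inj₁ refl) = inj₂ refl

  b-on-bL⇒∈ₚ : ∀ {w z} → L (bL w) (b z) ≡ true → z ∈ₚ w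
  b-on-bL⇒∈ₚ {w} {z} z∈ with on-line (bL-points w) (b z) z∈
  ... | inj₁ refl = inj₁ refl
  ... | inj₂ (inj₁ refl) = inj₂ refl

  line-through-p : ∀ k → L k p ≡ true → ∃[ i ] (k ≡ pL i)
  line-through-p (pL i) _ = i , refl

  line-through-p-point : ∀ s {k i} → L k p ≡ true → L k (point s i) ≡ true → k ≡ pL i
  line-through-p-point s {k} {i} p∈k i∈k with line-through-p k p∈k
  ... | j , refl with on-line (pL-side-points s j) (point s i) i∈k
  ...   | inj₁ e = ⊥-elim (point≢p s e)
  ...   | inj₂ (inj₁ e) = cong pL (sym (point-injective s e))
  ...   | inj₂ (inj₂ e) = ⊥-elim (point≢opposite s e)

  line-through-a-a : ∀ {k x y} → x ≢ y → L k (a x) ≡ true → L k (a y) ≡ true → k ≡ aL (pr x y)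
  line-through-a-a {pL i} {x} {y} x≢y x∈ y∈ with on-line (pL-points i) (a x) x∈ | on-line (pL-points i) (a y) y∈
  ... | inj₂ (inj₁ refl) | inj₂ (inj₁ refl) = ⊥-elim (x≢y refl)
  line-through-a-a {aL w} {x} {y} x≢y x∈ y∈ = cong aL (pair-of-elements w x y (a-on-aL⇒∈ₚ x∈) (a-on-aL⇒∈ₚ y∈) x≢y)

  line-through-b-b : ∀ {k x y} → x ≢ y → L k (b x) ≡ true → L k (b y) ≡ true → k ≡ bL (pr x y)
  line-through-b-b {pL i} {x} {y} x≢y x∈ y∈ with on-line (pL-points i) (b x) x∈ | on-line (pL-points i) (b y) y∈
  ... | inj₂ (inj₂ refl) | inj₂ (inj₂ refl) = ⊥-elim (x≢y refl)
  line-through-b-b {bL w} {x} {y} x≢y x∈ y∈ = cong bL (pair-of-elements w x y (b-on-bL⇒∈ₚ x∈) (b-on-bL⇒∈ₚ y∈) x≢y)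

  line-through-c-c : ∀ k {u v} → u ≢ v → L k (c u) ≡ true → L k (c v) ≡ true → ∃[ k₀ ] (k ≡ nL k₀)
  line-through-c-c (nL k₀) _ _ _ = k₀ , refl
  line-through-c-c (aL w) {u} {v} u≢v u∈ v∈ with on-line (aL-points w) (c u) u∈ | on-line (aL-points w) (c v) v∈
  ... | inj₂ (inj₂ refl) | inj₂ (inj₂ refl) = ⊥-elim (u≢v refl)
  line-through-c-c (bL w) {u} {v} u≢v u∈ v∈ with on-line (bL-points w) (c u) u∈ | on-line (bL-points w) (c v) v∈
  ... | inj₂ (inj₂ refl) | inj₂ (inj₂ refl) = ⊥-elim (u≢v refl)

  nL-or-non-c-point : ∀ k → (∃[ k₀ ] (k ≡ nL k₀)) ⊎ (∃[ x ] (L k x ≡ true × ¬ IsC x))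
  nL-or-non-c-point (nL k₀) = inj₁ (k₀ , refl)
  nL-or-non-c-point (aL w) = inj₂ (a (fst w) , point₁ (aL-points w) , point-not-c a-side)
  nL-or-non-c-point (bL w) = inj₂ (b (fst w) , point₁ (bL-points w) , point-not-c b-side)
  nL-or-non-c-point (pL i) = inj₂ (p , point₁ (pL-points i) , λ ())

  collinear-p-point : ∀ s i → Collinear L p (point s i)
  collinear-p-point s i = collinear (pL i) (point₁ (pL-side-points s i)) (point₂ (pL-side-points s i))

  collinear-p⇒point : ∀ {x} → Collinear L p x → x ≢ p → ∃[ s ] ∃[ i ] (x ≡ point s i)
  collinear-p⇒point (collinear k p∈k x∈k) x≢p with line-through-p k p∈k
  ... | i , refl with on-line (pL-points i) _ x∈k
  ...   | inj₁ x≡p = ⊥-elim (x≢p x≡p)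
  ...   | inj₂ (inj₁ x≡a) = a-side , i , x≡a
  ...   | inj₂ (inj₂ x≡b) = b-side , i , x≡b

  ¬collinear-p⇒c : ∀ x → ¬ Collinear L p x → IsC x
  ¬collinear-p⇒c p ¬col = ⊥-elim (¬col (collinear (pL 0F) refl refl))
  ¬collinear-p⇒c (a i) ¬col = ⊥-elim (¬col (collinear-p-point a-side i))
  ¬collinear-p⇒c (b i) ¬col = ⊥-elim (¬col (collinear-p-point b-side i))
  ¬collinear-p⇒c (c u) _ = u , refl

  ¬collinear-p-c : ∀ {u} → ¬ Collinear L p (c u)
  ¬collinear-p-c col with collinear-p⇒point col (λ ())
  ... | a-side , _ , ()
  ... | b-side , _ , ()

  collinear-point-point : ∀ s {i j} → i ≢ j → Collinear L (point s i) (point s j)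
  collinear-point-point a-side {i} {j} i≢j =
    collinear (aL (pr i j)) (point₁ (aL-pr-points i j i≢j)) (point₂ (aL-pr-points i j i≢j))
  collinear-point-point b-side {i} {j} i≢j =
    collinear (bL (pr i j)) (point₁ (bL-pr-points i j i≢j)) (point₂ (bL-pr-points i j i≢j))

  collinear-a-b⇒≡ : ∀ {i j} → Collinear L (a i) (b j) → i ≡ j
  collinear-a-b⇒≡ {i} {j} (collinear (pL m) a∈ b∈) with on-line (pL-points m) (a i) a∈ | on-line (pL-points m) (b j) b∈
  ... | inj₂ (inj₁ refl) | inj₂ (inj₂ refl) = refl

  collinear-opposite⇒≡ : ∀ s {i j} → Collinear L (point s i) (point (opposite s) j) → i ≡ j
  collinear-opposite⇒≡ a-side = collinear-a-b⇒≡
  collinear-opposite⇒≡ b-side = sym ∘ collinear-a-b⇒≡ ∘ collinear-sym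

  collinear-a-c⇒∈ₚ : ∀ {i w} → Collinear L (a i) (c w) → i ∈ₚ w
  collinear-a-c⇒∈ₚ {i} {w} (collinear (aL v) a∈ c∈) with on-line (aL-points v) (c w) c∈
  ... | inj₂ (inj₂ refl) = a-on-aL⇒∈ₚ a∈

  ∈ₚ⇒collinear-a-c : ∀ {i w} → i ∈ₚ w → Collinear L (a i) (c w)
  ∈ₚ⇒collinear-a-c {w = w} (inj₁ refl) = collinear (aL w) (point₁ (aL-points w)) (point₃ (aL-points w))
  ∈ₚ⇒collinear-a-c {w = w} (inj₂ refl) = collinear (aL w) (point₂ (aL-points w)) (point₃ (aL-points w))

  collinear-b-c⇒∉ₚ : ∀ {i s} → Collinear L (b i) (c s) → ¬ ψ i ∈ₚ s
  collinear-b-c⇒∉ₚ {i} {s} (collinear (bL w) b∈ c∈) with on-line (bL-points w) (b i) b∈ | on-line (bL-points w) (c s) c∈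
  ... | inj₁ refl | inj₂ (inj₂ refl) = ∉-ϰ-pr _ _ _ (fst≢snd w ∘ ψ-injective) (inj₁ refl)
  ... | inj₂ (inj₁ refl) | inj₂ (inj₂ refl) = ∉-ϰ-pr _ _ _ (fst≢snd w ∘ ψ-injective) (inj₂ refl)

  collinear-b-c : ∀ {i m} → i ≢ m → Collinear L (b i) (c (ϰ (pr (ψ i) (ψ m))))
  collinear-b-c {i} {m} i≢m = collinear (bL (pr i m)) (point₁ (bL-pr-points i m i≢m)) (point₃ (bL-pr-points i m i≢m))

  common-neighbours-a-c : ∀ u {x} → Collinear L (a (fst u)) x → Collinear L (c u) x →
    x ≢ a (fst u) → x ≢ a (snd u) → x ≢ c u → OneOf3 (b (fst u)) (c (sibling₁ u)) (c (sibling₂ u)) x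
  common-neighbours-a-c u {p} _ col _ _ _ = ⊥-elim (¬collinear-p-c (collinear-sym col))
  common-neighbours-a-c u {a j} _ col x≢fst x≢snd _ with collinear-a-c⇒∈ₚ (collinear-sym col)
  ... | inj₁ refl = ⊥-elim (x≢fst refl)
  ... | inj₂ refl = ⊥-elim (x≢snd refl)
  common-neighbours-a-c u {b j} col _ _ _ _ = inj₁ (cong b (sym (collinear-a-b⇒≡ col)))
  common-neighbours-a-c u {c v} col _ _ _ x≢cu with pairs-through-fst u v (collinear-a-c⇒∈ₚ col) (x≢cu ∘ cong c)
  ... | inj₁ refl = inj₂ (inj₁ refl)
  ... | inj₂ refl = inj₂ (inj₂ refl)

nL-correspondence : ∀ φ₁ φ₂ N₁ N₂ {F : Pt → Pt} {g : P2 → P2} → (∀ u → F (c u) ≡ c (g u)) → ∀ k k′ →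
  MapsLineOnto g (line N₁ k) (line N₂ k′) ⇔ MapsLineOnto F (KLine φ₁ N₁ (nL k)) (KLine φ₂ N₂ (nL k′))
nL-correspondence φ₁ φ₂ N₁ N₂ {F} {g} F-c k k′ = mk⇔ lift lower
  where
  module K₁ = Incidence φ₁ N₁
  module K₂ = Incidence φ₂ N₂
  lift : MapsLineOnto g (line N₁ k) (line N₂ k′) → MapsLineOnto F (K₁.L (nL k)) (K₂.L (nL k′))
  lift m y = mk⇔ to from
    where
    to : Image F (K₁.L (nL k)) y → K₂.L (nL k′) y ≡ true
    to (x , x∈ , refl) with K₁.nL-points k x x∈
    ... | r , refl , r∈ rewrite F-c r = Equivalence.to (m (g r)) (r , r∈ , refl)
    from : K₂.L (nL k′) y ≡ true → Image F (K₁.L (nL k)) y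
    from y∈ with K₂.nL-points k′ y y∈
    ... | s , refl , s∈ with Equivalence.from (m s) s∈
    ...   | r , r∈ , refl = c r , r∈ , F-c r
  lower : MapsLineOnto F (K₁.L (nL k)) (K₂.L (nL k′)) → MapsLineOnto g (line N₁ k) (line N₂ k′)
  lower m s = mk⇔ to from
    where
    to : Image g (line N₁ k) s → line N₂ k′ s ≡ true
    to (r , r∈ , refl) = Equivalence.to (m (c (g r))) (c r , r∈ , F-c r)
    from : line N₂ k′ s ≡ true → Image g (line N₁ k) s
    from s∈ with Equivalence.from (m (c s)) s∈
    ... | x , x∈ , Fx≡cs with K₁.nL-points k x x∈
    ...   | r , refl , r∈ = r , r∈ , c-injective (trans (sym (F-c r)) Fx≡cs)

ConditionA : Perm → Perm → Veblen → Veblen → (Pt → Pt) → Perm → Set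
ConditionA φ₁ φ₂ N₁ N₂ F α =
  (∀ i → F (a i) ≡ a (α ⟨$⟩ʳ i)) × (∀ i → F (b i) ≡ b (α ⟨$⟩ʳ i)) × (∀ u → F (c u) ≡ c (bar α u)) ×
  VIso N₁ N₂ (bar α) × (∀ i → φ₂ ⟨$⟩ʳ i ≡ α ⟨$⟩ʳ (φ₁ ⟨$⟩ʳ (α ⟨$⟩ˡ i)))

ConditionB : Perm → Perm → Veblen → Veblen → (Pt → Pt) → Perm → Set
ConditionB φ₁ φ₂ N₁ N₂ F α =
  (∀ i → F (a i) ≡ b (α ⟨$⟩ʳ i)) × (∀ i → F (b i) ≡ a (α ⟨$⟩ʳ i)) × (∀ u → F (c u) ≡ c (twisted φ₂ α u)) ×
  VIso N₁ N₂ (twisted φ₂ α) × (∀ i → φ₂ ⟨$⟩ˡ i ≡ α ⟨$⟩ʳ (φ₁ ⟨$⟩ʳ (α ⟨$⟩ˡ i)))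

-- Every isomorphism satisfies condition (a) or (b)

module Forward (φ₁ φ₂ : Perm) (N₁ N₂ : Veblen) (f : Pt ↔ Pt)
               (maps : MapsLinesOnto (Inverse.to f) (KLine φ₁ N₁) (KLine φ₂ N₂)) where

  open LineBijection f maps
  module K₁ = Incidence φ₁ N₁
  module K₂ = Incidence φ₂ N₂
  open K₁ using () renaming (L to L₁)
  open K₂ using () renaming (L to L₂; ψ to ψ₂)

  preimage-of-non-neighbour : ∀ {y} → ¬ Collinear L₂ (F p) y → IsC (G y)
  preimage-of-non-neighbour {y} ¬col =
    K₁.¬collinear-p⇒c (G y) (¬col ∘ subst (Collinear L₂ (F p)) (F∘G y) ∘ collinear-image)

  non-neighbours-of-Fp-closed : ∀ {q} k {y₁ y₂ z} → F p ≡ q → y₁ ≢ y₂ →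
    ¬ Collinear L₂ q y₁ → ¬ Collinear L₂ q y₂ →
    L₂ k y₁ ≡ true → L₂ k y₂ ≡ true → L₂ k z ≡ true → ¬ Collinear L₂ q z
  non-neighbours-of-Fp-closed k {y₁} {y₂} {z} refl y₁≢y₂ ¬col₁ ¬col₂ y₁∈ y₂∈ z∈ col
    with preimage-of-non-neighbour ¬col₁ | preimage-of-non-neighbour ¬col₂
  ... | u₁ , Gy₁≡cu₁ | u₂ , Gy₂≡cu₂
    with K₁.line-through-c-c (preimage-line k) (λ { refl → y₁≢y₂ (G-injective (trans Gy₁≡cu₁ (sym Gy₂≡cu₂))) })
           (G-on-preimage-line k Gy₁≡cu₁ y₁∈) (G-on-preimage-line k Gy₂≡cu₂ y₂∈)
  ... | k₀ , k≡nL with K₁.nL-points k₀ (G z) (subst (λ t → L₁ t (G z) ≡ true) k≡nL (G-on-preimage-line k refl z∈))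
  ...   | r , Gz≡cr , _ = K₁.¬collinear-p-c (subst (Collinear L₁ p) Gz≡cr (collinear-preimage col))

  -- The b-line through b x and b y (x, y ∉ {i, φ₂ i}) has two points not collinear with a i,
  -- while its third point is collinear with a i.
  Fp≢a : ∀ i → F p ≢ a i
  Fp≢a i Fp≡ai with two-outside i (φ₂ ⟨$⟩ʳ i)
  ... | x , y , x≢y , i≢x , i≢y , φi≢x , φi≢y =
    non-neighbours-of-Fp-closed (bL (pr x y)) Fp≡ai (x≢y ∘ point-injective b-side)
      (i≢x ∘ K₂.collinear-a-b⇒≡) (i≢y ∘ K₂.collinear-a-b⇒≡)
      (point₁ b-line) (point₂ b-line) (point₃ b-line)
      (K₂.∈ₚ⇒collinear-a-c (∈-ϰ-pr i (ψ₂ x) (ψ₂ y) (x≢y ∘ K₂.ψ-injective) (avoids φi≢x) (avoids φi≢y)))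
    where
    b-line : HasPoints L₂ (bL (pr x y)) (b x) (b y) (c (ϰ (pr (ψ₂ x) (ψ₂ y))))
    b-line = K₂.bL-pr-points x y x≢y
    avoids : ∀ {m} → φ₂ ⟨$⟩ʳ i ≢ m → i ≢ ψ₂ m
    avoids φi≢m i≡ψm = φi≢m (trans (cong (φ₂ ⟨$⟩ʳ_) i≡ψm) (inverseʳ φ₂))

  -- Dually, the a-line through c w, where c w lies on a b-line through b i and i ∉ w, has two
  -- points not collinear with b i.
  Fp≢b : ∀ i → F p ≢ b i
  Fp≢b i Fp≡bi with partner i (φ₂ ⟨$⟩ʳ i)
  ... | m , i≢m , φi∈ =
    non-neighbours-of-Fp-closed (aL w) Fp≡bi (fst≢snd w ∘ point-injective a-side)
      (λ col → i∉w (inj₁ (K₂.collinear-a-b⇒≡ (collinear-sym col))))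
      (λ col → i∉w (inj₂ (K₂.collinear-a-b⇒≡ (collinear-sym col))))
      (point₁ (K₂.aL-points w)) (point₂ (K₂.aL-points w)) (point₃ (K₂.aL-points w))
      (K₂.collinear-b-c i≢m)
    where
    w : P2
    w = ϰ (pr (ψ₂ i) (ψ₂ m))
    returns : φ₂ ⟨$⟩ʳ i ≡ i ⊎ φ₂ ⟨$⟩ʳ i ≡ m → i ≡ ψ₂ i ⊎ i ≡ ψ₂ m
    returns (inj₁ φi≡i) = inj₁ (trans (sym (inverseˡ φ₂)) (cong ψ₂ φi≡i))
    returns (inj₂ φi≡m) = inj₂ (trans (sym (inverseˡ φ₂)) (cong ψ₂ φi≡m))
    i∉w : ¬ i ∈ₚ w
    i∉w = ∉-ϰ-pr i (ψ₂ i) (ψ₂ m) (i≢m ∘ K₂.ψ-injective) (returns φi∈)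

  -- The images of the three points point s n, n ≢ m, are pairwise collinear common neighbours
  -- of a (fst u) and c u, so they fill {b (fst u), c (sibling₁ u), c (sibling₂ u)}; but b (fst u)
  -- is not collinear with c v for the pair v through fst u that contains ψ₂ (fst u).
  Fp≡c-impossible : ∀ s u m → F p ≡ c u → F (point s m) ≡ a (fst u) → ⊥
  Fp≡c-impossible s u m Fp≡cu FSm≡ai with three-others m
  ... | n₁ , n₂ , n₃ , m≢n₁ , m≢n₂ , m≢n₃ , n₁≢n₂ , n₁≢n₃ , n₂≢n₃
    with pigeonhole-three {R = Collinear L₂} {P = Collinear L₂ (c u)} collinear-sym
           (options m≢n₁) (options m≢n₂) (options m≢n₃)
           (distinct n₁≢n₂) (distinct n₁≢n₃) (distinct n₂≢n₃)
           (collinear-z n₁≢n₂) (collinear-z n₁≢n₃) (collinear-z n₂≢n₃)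
           (collinear-cu n₁) (collinear-cu n₂) (collinear-cu n₃)
    where
    i : I₄
    i = fst u
    z : I₄ → Pt
    z n = F (point s n)
    distinct : ∀ {n n′} → n ≢ n′ → z n ≢ z n′
    distinct n≢n′ = n≢n′ ∘ point-injective s ∘ F-injective
    collinear-z : ∀ {n n′} → n ≢ n′ → Collinear L₂ (z n) (z n′)
    collinear-z n≢n′ = collinear-image (K₁.collinear-point-point s n≢n′)
    collinear-cu : ∀ n → Collinear L₂ (c u) (z n)
    collinear-cu n = subst (λ q → Collinear L₂ q (z n)) Fp≡cu (collinear-image (K₁.collinear-p-point s n))
    collinear-ai : ∀ {n} → m ≢ n → Collinear L₂ (a i) (z n)
    collinear-ai {n} m≢n = subst (λ q → Collinear L₂ q (z n)) FSm≡ai (collinear-image (K₁.collinear-point-point s m≢n))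
    a-line : HasPoints L₂ (aL u) (a i) (a (snd u)) (c u)
    a-line = K₂.aL-points u
    through : ∀ n {y} → F (point s n) ≡ y → L₂ (aL u) y ≡ true → preimage-line (aL u) ≡ pL n
    through n e y∈ = K₁.line-through-p-point s (on-preimage-line (aL u) Fp≡cu (point₃ a-line))
                                                (on-preimage-line (aL u) e y∈)
    not-a-snd : ∀ {n} → m ≢ n → z n ≢ a (snd u)
    not-a-snd {n} m≢n zn≡asnd =
      m≢n (pL-injective (trans (sym (through m FSm≡ai (point₁ a-line))) (through n zn≡asnd (point₂ a-line))))
    options : ∀ {n} → m ≢ n → OneOf3 (b i) (c (sibling₁ u)) (c (sibling₂ u)) (z n)
    options {n} m≢n = K₂.common-neighbours-a-c u (collinear-ai m≢n) (collinear-cu n)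
      (λ zn≡ai → m≢n (point-injective s (F-injective (trans FSm≡ai (sym zn≡ai)))))
      (not-a-snd m≢n)
      (λ zn≡cu → point≢p s (F-injective (trans zn≡cu (sym Fp≡cu))))
  ... | bi~s₁ , bi~s₂ , cu~bi with pairs-through-fst-cover u (ψ₂ (fst u))
  ...   | inj₁ ψi∈u = K₂.collinear-b-c⇒∉ₚ (collinear-sym cu~bi) ψi∈u
  ...   | inj₂ (inj₁ ψi∈s₁) = K₂.collinear-b-c⇒∉ₚ bi~s₁ ψi∈s₁
  ...   | inj₂ (inj₂ ψi∈s₂) = K₂.collinear-b-c⇒∉ₚ bi~s₂ ψi∈s₂

  Fp≢c : ∀ u → F p ≢ c u
  Fp≢c u Fp≡cu with K₁.collinear-p⇒point (collinear-preimage Fp~ai) Gai≢p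
    where
    Fp~ai : Collinear L₂ (F p) (a (fst u))
    Fp~ai = subst (λ q → Collinear L₂ q (a (fst u))) (sym Fp≡cu) (collinear-sym (K₂.∈ₚ⇒collinear-a-c (inj₁ refl)))
    Gai≢p : G (a (fst u)) ≢ p
    Gai≢p Gai≡p with trans (sym (F∘G (a (fst u)))) (trans (cong F Gai≡p) Fp≡cu)
    ... | ()
  ... | s , m , Gai≡Sm = Fp≡c-impossible s u m Fp≡cu (trans (cong F (sym Gai≡Sm)) (F∘G (a (fst u))))

  F-fixes-p : F p ≡ p
  F-fixes-p with F p in Fp≡
  ... | p = refl
  ... | a i = ⊥-elim (Fp≢a i Fp≡)
  ... | b i = ⊥-elim (Fp≢b i Fp≡)
  ... | c u = ⊥-elim (Fp≢c u Fp≡)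

  image-of-point : ∀ s i → ∃[ t ] ∃[ j ] (F (point s i) ≡ point t j)
  image-of-point s i = K₂.collinear-p⇒point
    (subst (λ q → Collinear L₂ q (F (point s i))) F-fixes-p (collinear-image (K₁.collinear-p-point s i)))
    (λ e → point≢p s (F-injective (trans e (sym F-fixes-p))))

  preimage-of-point : ∀ t j → ∃[ s ] ∃[ i ] (G (point t j) ≡ point s i)
  preimage-of-point t j = K₁.collinear-p⇒point
    (collinear-preimage (subst (λ q → Collinear L₂ q (point t j)) (sym F-fixes-p) (K₂.collinear-p-point t j)))
    (λ e → point≢p t (trans (sym (F∘G (point t j))) (trans (cong F e) F-fixes-p)))

  -- Otherwise a 0F and a i are sent to collinear points of opposite sides, hence to point t j and
  -- point (opposite t) j, and the line pL j through them and p would pull back to a line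
  -- through p, a 0F and a i.
  a-points-stay-on-one-side : ∀ {t j₀} → F (a 0F) ≡ point t j₀ → ∀ i → ∃[ j ] (F (a i) ≡ point t j)
  a-points-stay-on-one-side {t} {j₀} F0≡ i with image-of-point a-side i
  ... | t′ , j , Fi≡ with side-cases t t′
  ...   | inj₁ refl = j , Fi≡
  ...   | inj₂ refl with i ≟F 0F
  ...     | yes refl = ⊥-elim (point≢opposite t (trans (sym F0≡) Fi≡))
  ...     | no i≢0 = ⊥-elim (i≢0 (pL-injective (trans (sym (through refl Fi≡)) (through j₀≡j F0≡))))
    where
    j₀≡j : j₀ ≡ j
    j₀≡j = K₂.collinear-opposite⇒≡ t
             (subst₂ (Collinear L₂) F0≡ Fi≡ (collinear-image (K₁.collinear-point-point a-side (i≢0 ∘ sym))))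
    p∈ : L₁ (preimage-line (pL j)) p ≡ true
    p∈ = on-preimage-line (pL j) F-fixes-p (point₁ (K₂.pL-points j))
    through : ∀ {m s j′} → j′ ≡ j → F (a m) ≡ point s j′ → preimage-line (pL j) ≡ pL m
    through {s = s} refl e = K₁.line-through-p-point a-side p∈
                               (on-preimage-line (pL j) e (point₂ (K₂.pL-side-points s j)))

  nL-image-is-nL : (∀ u → IsC (F (c u))) → ∀ k → ∃[ k′ ] (image-line (nL k) ≡ nL k′)
  nL-image-is-nL F-c k with K₂.nL-or-non-c-point (image-line (nL k))
  ... | inj₁ is-nL = is-nL
  ... | inj₂ (y , y∈ , y-not-c) with Equivalence.from (image-line-onto (nL k) y) y∈
  ...   | x , x∈ , refl with K₁.nL-points k x x∈
  ...     | r , refl , _ = ⊥-elim (y-not-c (F-c r))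

  nL-preimage-is-nL : (∀ x → IsC (F x) → IsC x) → ∀ k′ → ∃[ k ] (preimage-line (nL k′) ≡ nL k)
  nL-preimage-is-nL reflects-c k′ with K₁.nL-or-non-c-point (preimage-line (nL k′))
  ... | inj₁ is-nL = is-nL
  ... | inj₂ (x , x∈ , x-not-c)
    with K₂.nL-points k′ (F x) (Equivalence.to (preimage-line-onto (nL k′) (F x)) (x , x∈ , refl))
  ...   | r , Fx≡cr , _ = ⊥-elim (x-not-c (reflects-c x (r , Fx≡cr)))

  veblen-isomorphism : ∀ {g} (h : P2 → P2) → (∀ u → h (g u) ≡ u) → (∀ v → g (h v) ≡ v) →
    (∀ u → F (c u) ≡ c (g u)) → (∀ x → IsC (F x) → IsC x) → VIso N₁ N₂ g
  veblen-isomorphism {g} h hg gh F-c reflects-c = bijective-from-inverse h hg gh , forth , back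
    where
    forth : ∀ k → ∃[ k′ ] MapsLineOnto g (line N₁ k) (line N₂ k′)
    forth k with nL-image-is-nL (λ u → g u , F-c u) k
    ... | k′ , e = k′ , Equivalence.from (nL-correspondence φ₁ φ₂ N₁ N₂ F-c k k′)
                          (subst (λ t → MapsLineOnto F (L₁ (nL k)) (L₂ t)) e (image-line-onto (nL k)))
    back : ∀ k′ → ∃[ k ] MapsLineOnto g (line N₁ k) (line N₂ k′)
    back k′ with nL-preimage-is-nL reflects-c k′
    ... | k , e = k , Equivalence.from (nL-correspondence φ₁ φ₂ N₁ N₂ F-c k k′)
                        (subst (λ t → MapsLineOnto F (L₁ t) (L₂ (nL k′))) e (preimage-line-onto (nL k′)))

  module APointsTo (t : Side) (a-image : ∀ i → ∃[ j ] (F (a i) ≡ point t j)) where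

    α-map : I₄ → I₄
    α-map i = proj₁ (a-image i)

    F-a : ∀ i → F (a i) ≡ point t (α-map i)
    F-a i = proj₂ (a-image i)

    F-b : ∀ i → F (b i) ≡ point (opposite t) (α-map i)
    F-b i = image-of-third-point (K₁.pL-points i) (K₂.pL-side-points t (α-map i)) (K₂.line-through-p-point t)
              (λ ()) (λ ()) F-fixes-p (F-a i)

    preimage-on-a-side : ∀ y → ∃[ x ] (G (point t y) ≡ a x)
    preimage-on-a-side y with preimage-of-point t y
    ... | a-side , x , e = x , e
    ... | b-side , x , e = ⊥-elim (point≢opposite t (trans (sym (F∘G (point t y))) (trans (cong F e) (F-b x))))

    α-inv : I₄ → I₄
    α-inv y = proj₁ (preimage-on-a-side y)

    α-map∘α-inv : ∀ y → α-map (α-inv y) ≡ y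
    α-map∘α-inv y = point-injective t (trans (sym (F-a (α-inv y)))
                      (trans (cong F (sym (proj₂ (preimage-on-a-side y)))) (F∘G (point t y))))

    α-inv∘α-map : ∀ i → α-inv (α-map i) ≡ i
    α-inv∘α-map i = point-injective a-side
      (trans (sym (proj₂ (preimage-on-a-side (α-map i)))) (trans (cong G (sym (F-a i))) (G∘F (a i))))

    α : Perm
    α = mk↔ₛ′ α-map α-inv α-map∘α-inv α-inv∘α-map

    reflects-c : ∀ x → IsC (F x) → IsC x
    reflects-c p Fp-c with subst IsC F-fixes-p Fp-c
    ... | _ , ()
    reflects-c (a i) Fa-c = ⊥-elim (point-not-c t (subst IsC (F-a i) Fa-c))
    reflects-c (b i) Fb-c = ⊥-elim (point-not-c (opposite t) (subst IsC (F-b i) Fb-c))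
    reflects-c (c u) _ = u , refl

  module CaseA (a-image : ∀ i → ∃[ j ] (F (a i) ≡ a j)) where
    open APointsTo a-side a-image public

    F-c : ∀ u → F (c u) ≡ c (bar α u)
    F-c u = image-of-third-point (K₁.aL-points u) (K₂.aL-pr-points _ _ (perm-separates-pair α u))
              (K₂.line-through-a-a (perm-separates-pair α u)) (λ ()) (λ ()) (F-a (fst u)) (F-a (snd u))

    F-c-on-bL : ∀ w → F (c (K₁.c-on-bL w)) ≡ c (ϰ (barF (λ i → φ₂ ⟨$⟩ˡ (α ⟨$⟩ʳ i)) w))
    F-c-on-bL w = image-of-third-point (K₁.bL-points w) (K₂.bL-pr-points _ _ (perm-separates-pair α w))
                    (K₂.line-through-b-b (perm-separates-pair α w)) (λ ()) (λ ()) (F-b (fst w)) (F-b (snd w))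

    condition : ConditionA φ₁ φ₂ N₁ N₂ F α
    condition = F-a , F-b , F-c ,
      veblen-isomorphism (barF α-inv) (barF-inverse {α-inv} (perm-injective α) α-inv∘α-map)
                                      (barF-inverse {α-map} (perm⁻¹-injective α) α-map∘α-inv) F-c reflects-c ,
      Equivalence.to (conjugation φ₁ α (φ₂ ⟨$⟩ʳ_))
        (Equivalence.to (b-lines-compatible-A φ₁ φ₂ α)
          (λ w → c-injective (trans (sym (F-c (K₁.c-on-bL w))) (F-c-on-bL w))))

  module CaseB (a-image : ∀ i → ∃[ j ] (F (a i) ≡ b j)) where
    open APointsTo b-side a-image public

    F-c : ∀ u → F (c u) ≡ c (twisted φ₂ α u)
    F-c u = image-of-third-point (K₁.aL-points u) (K₂.bL-pr-points _ _ (perm-separates-pair α u))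
              (K₂.line-through-b-b (perm-separates-pair α u)) (λ ()) (λ ()) (F-a (fst u)) (F-a (snd u))

    F-c-on-bL : ∀ w → F (c (K₁.c-on-bL w)) ≡ c (bar α w)
    F-c-on-bL w = image-of-third-point (K₁.bL-points w) (K₂.aL-pr-points _ _ (perm-separates-pair α w))
                    (K₂.line-through-a-a (perm-separates-pair α w)) (λ ()) (λ ()) (F-b (fst w)) (F-b (snd w))

    ψ₂∘α : I₄ → I₄
    ψ₂∘α i = ψ₂ (α-map i)

    α⁻¹∘φ₂ : I₄ → I₄
    α⁻¹∘φ₂ i = α-inv (φ₂ ⟨$⟩ʳ i)

    untwist : P2 → P2
    untwist v = barF α⁻¹∘φ₂ (ϰ v)

    untwist-twisted : ∀ u → untwist (twisted φ₂ α u) ≡ u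
    untwist-twisted u = trans (cong (barF α⁻¹∘φ₂) (ϰ-involutive (barF ψ₂∘α u)))
      (barF-inverse {α⁻¹∘φ₂} {ψ₂∘α} (perm-injective α ∘ perm⁻¹-injective φ₂)
                    (λ i → trans (cong α-inv (inverseʳ φ₂)) (α-inv∘α-map i)) u)

    twisted-untwist : ∀ v → twisted φ₂ α (untwist v) ≡ v
    twisted-untwist v = trans (cong ϰ
      (barF-inverse {ψ₂∘α} {α⁻¹∘φ₂} (perm-injective φ₂ ∘ perm⁻¹-injective α)
                    (λ i → trans (cong ψ₂ (α-map∘α-inv _)) (inverseˡ φ₂)) (ϰ v)))
      (ϰ-involutive v)

    condition : ConditionB φ₁ φ₂ N₁ N₂ F α
    condition = F-a , F-b , F-c ,
      veblen-isomorphism untwist untwist-twisted twisted-untwist F-c reflects-c ,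
      Equivalence.to (conjugation φ₁ α (φ₂ ⟨$⟩ˡ_))
        (Equivalence.to (b-lines-compatible-B φ₁ φ₂ α)
          (λ w → c-injective (trans (sym (F-c (K₁.c-on-bL w))) (F-c-on-bL w))))

  isomorphism⇒condition : ∃[ α ] (ConditionA φ₁ φ₂ N₁ N₂ F α ⊎ ConditionB φ₁ φ₂ N₁ N₂ F α)
  isomorphism⇒condition with image-of-point a-side 0F
  ... | a-side , _ , F0≡ = CaseA.α _ , inj₁ (CaseA.condition (a-points-stay-on-one-side F0≡))
  ... | b-side , _ , F0≡ = CaseB.α _ , inj₂ (CaseB.condition (a-points-stay-on-one-side F0≡))

-- Every map satisfying condition (a) or (b) is an isomorphism

module Backward (φ₁ φ₂ : Perm) (N₁ N₂ : Veblen) (f : Pt ↔ Pt) where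

  module K₁ = Incidence φ₁ N₁
  module K₂ = Incidence φ₂ N₂
  open K₁ using () renaming (L to L₁)
  open K₂ using () renaming (L to L₂)

  F : Pt → Pt
  F = Inverse.to f

  fixes-p : (∀ x → F x ≡ p → x ≡ p) → F p ≡ p
  fixes-p only-p = subst (λ x → F x ≡ p) (only-p (Inverse.from f p) F∘G-p) F∘G-p
    where
    F∘G-p : F (Inverse.from f p) ≡ p
    F∘G-p = Inverse.inverseˡ f refl

  lines-onto-from-line-images : ∀ (s : Side) (α : Perm) {g : P2 → P2} →
    (∀ u → F (c u) ≡ c (g u)) → MapsLinesOnto g (line N₁) (line N₂) →
    (∀ i → MapsLineOnto F (L₁ (pL i)) (L₂ (pL (α ⟨$⟩ʳ i)))) →
    (∀ w → MapsLineOnto F (L₁ (aL w)) (L₂ (sideLine s (bar α w)))) →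
    (∀ w → MapsLineOnto F (L₁ (bL w)) (L₂ (sideLine (opposite s) (bar α w)))) →
    MapsLinesOnto F L₁ L₂
  lines-onto-from-line-images s α F-c (veblen-forth , veblen-back) pL-image aL-image bL-image = forth , back
    where
    forth : ∀ k → ∃[ k′ ] MapsLineOnto F (L₁ k) (L₂ k′)
    forth (nL k) = nL (proj₁ (veblen-forth k)) ,
                   Equivalence.to (nL-correspondence φ₁ φ₂ N₁ N₂ F-c k _) (proj₂ (veblen-forth k))
    forth (aL w) = sideLine s (bar α w) , aL-image w
    forth (bL w) = sideLine (opposite s) (bar α w) , bL-image w
    forth (pL i) = pL (α ⟨$⟩ʳ i) , pL-image i
    bar-α-α⁻¹ : ∀ v → bar α (barF (α ⟨$⟩ˡ_) v) ≡ v
    bar-α-α⁻¹ = barF-inverse {α ⟨$⟩ʳ_} (perm⁻¹-injective α) (λ _ → inverseʳ α)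
    preimage-of-side-line : ∀ t v → ∃[ k ] MapsLineOnto F (L₁ k) (L₂ (sideLine t v))
    preimage-of-side-line t v with side-cases s t
    ... | inj₁ refl = aL w , subst (λ u → MapsLineOnto F (L₁ (aL w)) (L₂ (sideLine s u))) (bar-α-α⁻¹ v) (aL-image w)
      where w = barF (α ⟨$⟩ˡ_) v
    ... | inj₂ refl = bL w , subst (λ u → MapsLineOnto F (L₁ (bL w)) (L₂ (sideLine (opposite s) u))) (bar-α-α⁻¹ v)
                                   (bL-image w)
      where w = barF (α ⟨$⟩ˡ_) v
    back : ∀ k′ → ∃[ k ] MapsLineOnto F (L₁ k) (L₂ k′)
    back (nL k′) = nL (proj₁ (veblen-back k′)) ,
                   Equivalence.to (nL-correspondence φ₁ φ₂ N₁ N₂ F-c _ k′) (proj₂ (veblen-back k′))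
    back (aL v) = preimage-of-side-line a-side v
    back (bL v) = preimage-of-side-line b-side v
    back (pL j) = pL (α ⟨$⟩ˡ j) ,
                  subst (λ i → MapsLineOnto F (L₁ (pL (α ⟨$⟩ˡ j))) (L₂ (pL i))) (inverseʳ α) (pL-image (α ⟨$⟩ˡ j))

  conditionA⇒isomorphism : ∀ α → ConditionA φ₁ φ₂ N₁ N₂ F α → MapsLinesOnto F L₁ L₂
  conditionA⇒isomorphism α (F-a , F-b , F-c , (_ , veblen-lines) , conj) =
    lines-onto-from-line-images a-side α F-c veblen-lines
      (λ i → three-point-lines-correspond (K₁.pL-points i) (K₂.pL-points _) F-p (F-a i) (F-b i))
      (λ w → three-point-lines-correspond (K₁.aL-points w) (K₂.aL-pr-points _ _ (perm-separates-pair α w))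
               (F-a _) (F-a _) (F-c w))
      (λ w → three-point-lines-correspond (K₁.bL-points w) (K₂.bL-pr-points _ _ (perm-separates-pair α w))
               (F-b _) (F-b _) (trans (F-c (K₁.c-on-bL w)) (cong c (b-compatible w))))
    where
    F-p : F p ≡ p
    F-p = fixes-p λ { p _ → refl
                    ; (a i) e → ⊥-elim (point≢p a-side (trans (sym (F-a i)) e))
                    ; (b i) e → ⊥-elim (point≢p b-side (trans (sym (F-b i)) e))
                    ; (c u) e → ⊥-elim (c≢p (trans (sym (F-c u)) e)) }
    b-compatible : ∀ w → bar α (K₁.c-on-bL w) ≡ ϰ (barF (λ i → φ₂ ⟨$⟩ˡ (α ⟨$⟩ʳ i)) w)
    b-compatible = Equivalence.from (b-lines-compatible-A φ₁ φ₂ α)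
                     (Equivalence.from (conjugation φ₁ α (φ₂ ⟨$⟩ʳ_)) conj)

  conditionB⇒isomorphism : ∀ α → ConditionB φ₁ φ₂ N₁ N₂ F α → MapsLinesOnto F L₁ L₂
  conditionB⇒isomorphism α (F-a , F-b , F-c , (_ , veblen-lines) , conj) =
    lines-onto-from-line-images b-side α F-c veblen-lines
      (λ i → three-point-lines-correspond (K₁.pL-points i) (K₂.pL-side-points b-side _) F-p (F-a i) (F-b i))
      (λ w → three-point-lines-correspond (K₁.aL-points w) (K₂.bL-pr-points _ _ (perm-separates-pair α w))
               (F-a _) (F-a _) (F-c w))
      (λ w → three-point-lines-correspond (K₁.bL-points w) (K₂.aL-pr-points _ _ (perm-separates-pair α w))
               (F-b _) (F-b _) (trans (F-c (K₁.c-on-bL w)) (cong c (b-compatible w))))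
    where
    F-p : F p ≡ p
    F-p = fixes-p λ { p _ → refl
                    ; (a i) e → ⊥-elim (point≢p b-side (trans (sym (F-a i)) e))
                    ; (b i) e → ⊥-elim (point≢p a-side (trans (sym (F-b i)) e))
                    ; (c u) e → ⊥-elim (c≢p (trans (sym (F-c u)) e)) }
    b-compatible : ∀ w → twisted φ₂ α (K₁.c-on-bL w) ≡ bar α w
    b-compatible = Equivalence.from (b-lines-compatible-B φ₁ φ₂ α)
                     (Equivalence.from (conjugation φ₁ α (φ₂ ⟨$⟩ˡ_)) conj)

proposition4p5 :
    (φ₁ φ₂ : Perm) (N₁ N₂ : Veblen) (f : Pt ↔ Pt) →
    (MapsLinesOnto (Inverse.to f) (KLine φ₁ N₁) (KLine φ₂ N₂)
      ⇔
     (∃[ α ]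
       (((∀ i → Inverse.to f (a i) ≡ a (α ⟨$⟩ʳ i))
         × (∀ i → Inverse.to f (b i) ≡ b (α ⟨$⟩ʳ i))
         × (∀ u → Inverse.to f (c u) ≡ c (bar α u))
         × VIso N₁ N₂ (bar α)
         × (∀ i → φ₂ ⟨$⟩ʳ i ≡ α ⟨$⟩ʳ (φ₁ ⟨$⟩ʳ (α ⟨$⟩ˡ i))))
        ⊎
        ((∀ i → Inverse.to f (a i) ≡ b (α ⟨$⟩ʳ i))
         × (∀ i → Inverse.to f (b i) ≡ a (α ⟨$⟩ʳ i))
         × (∀ u → Inverse.to f (c u) ≡ c (ϰ (barF (λ i → φ₂ ⟨$⟩ˡ (α ⟨$⟩ʳ i)) u)))
         × VIso N₁ N₂ (λ u → ϰ (barF (λ i → φ₂ ⟨$⟩ˡ (α ⟨$⟩ʳ i)) u))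
         × (∀ i → φ₂ ⟨$⟩ˡ i ≡ α ⟨$⟩ʳ (φ₁ ⟨$⟩ʳ (α ⟨$⟩ˡ i)))))))
    ×
    (∀ (α : Perm) → (∀ i → φ₂ ⟨$⟩ˡ i ≡ α ⟨$⟩ʳ (φ₁ ⟨$⟩ʳ (α ⟨$⟩ˡ i))) →
      ∀ u → ϰ (barF (λ i → φ₂ ⟨$⟩ˡ (α ⟨$⟩ʳ i)) u) ≡ ϰ (barF (λ i → α ⟨$⟩ʳ (φ₁ ⟨$⟩ʳ i)) u))
proposition4p5 φ₁ φ₂ N₁ N₂ f = mk⇔ (Forward.isomorphism⇒condition φ₁ φ₂ N₁ N₂ f) condition⇒isomorphism ,
                               twisted-via-conjugate φ₁ φ₂
  where
  open Backward φ₁ φ₂ N₁ N₂ f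
  condition⇒isomorphism : ∃[ α ] (ConditionA φ₁ φ₂ N₁ N₂ F α ⊎ ConditionB φ₁ φ₂ N₁ N₂ F α) →
                          MapsLinesOnto F (KLine φ₁ N₁) (KLine φ₂ N₂)
  condition⇒isomorphism (α , inj₁ type-a) = conditionA⇒isomorphism α type-a
  condition⇒isomorphism (α , inj₂ type-b) = conditionB⇒isomorphism α type-b
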